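{- Let $n\ge 3$ and let $v_i, v_j$ ($1\le i\ne j\le n$) be two cycle vertices of the wheel graph $W_{n+1}$, and let $k=\min(|i-j|,\, n-|i-j|)$ be their distance along the rim cycle. Then the number $F_{W_{n+1}}(v_i\mid v_j)$ of two-component spanning forests of $W_{n+1}$ in which $v_i$ and $v_j$ belong to different components is \[ F_{W_{n+1}}(v_i\mid v_j)= f_{2k}\,\mathscr{T}(W_{n+1}) - f_{2n}(\ell_{2k}-2) = f_{2k}(\ell_{2n}-2)-f_{2n}(\ell_{2k}-2), \] where $\mathscr{T}(W_{n+1})$ is the number of spanning trees of $W_{n+1}$.
   Context: The wheel graph $W_{n+1}$ has vertices $v_c, v_1,\dots,v_n$; its edges are the spokes $\{v_c,v_i\}$ and the cycle edges $\{v_i,v_{i+1}\}$ ($1\le i\le n-1$) and $\{v_n,v_1\}$. A two-component spanning forest is an acyclic spanning subgraph with exactly two connected components. $f_i$ are the Fibonacci numbers ($f_0=0$, $f_1=1$, $f_{i+2}=f_{i+1}+f_i$) and $\ell_j$ the Lucas numbers ($\ell_0=2$, $\ell_1=1$, $\ell_{j+2}=\ell_{j+1}+\ell_j$). -}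

module Defs where

open import Data.Bool using (Bool; true; false; _∧_; _∨_; not; if_then_else_)
open import Data.Nat using (ℕ; zero; suc; _+_; _∸_; _≡ᵇ_; _<ᵇ_)
open import Data.List using (List; []; _∷_; _++_; map; length; filterᵇ; upTo)
open import Data.Bool.ListAction using (any; all)
open import Data.Product using (_×_; _,_)
open import Data.Integer using (ℤ)

fib : ℕ → ℕ
fib 0 = 0
fib 1 = 1
fib (suc (suc i)) = fib (suc i) + fib i

lucas : ℕ → ℕ
lucas 0 = 2
lucas 1 = 1
lucas (suc (suc j)) = lucas (suc j) + lucas j

-- Graphs on vertex set {0,…,N-1} (ℕ labels), given by an edge list.
Edge : Set
Edge = ℕ × ℕ

-- Wheel W_{n+1}: centre v_c = 0, rim vertices v_1,…,v_n = 1,…,n.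
-- Vertex set {0,…,n}.
wheelVertices : ℕ → List ℕ
wheelVertices n = upTo (suc n)

spokes : ℕ → List Edge
spokes n = map (λ m → (0 , suc m)) (upTo n)

rimPath : ℕ → List Edge
rimPath n = map (λ m → (suc m , suc (suc m))) (upTo (n ∸ 1))

wheelEdges : ℕ → List Edge
wheelEdges n = spokes n ++ rimPath n ++ ((n , 1) ∷ [])

-- all sub-lists of a list (2^m of them) : the spanning subgraphs (edge subsets)
sublists : {A : Set} → List A → List (List A)
sublists [] = [] ∷ []
sublists (x ∷ xs) = let r = sublists xs in r ++ map (x ∷_) r

picks : {A : Set} → List A → List (A × List A)
picks [] = []
picks (x ∷ xs) = (x , xs) ∷ map (λ { (y , ys) → (y , x ∷ ys) }) (picks xs)

adj : List Edge → ℕ → ℕ → Bool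
adj S u v = any (λ { (a , b) → ((a ≡ᵇ u) ∧ (b ≡ᵇ v)) ∨ ((a ≡ᵇ v) ∧ (b ≡ᵇ u)) }) S

reachK : ℕ → List ℕ → List Edge → ℕ → ℕ → Bool
reachK zero V S u v = u ≡ᵇ v
reachK (suc k) V S u v = reachK k V S u v ∨ any (λ w → reachK k V S u w ∧ adj S w v) V

-- connectivity: a walk exists iff one of length ≤ |V| exists
connected : List ℕ → List Edge → ℕ → ℕ → Bool
connected V S = reachK (length V) V S

-- number of connected components: vertices that are the least of their component
components : List ℕ → List Edge → ℕ
components V S = length (filterᵇ (λ v → all (λ u → not ((u <ᵇ v) ∧ connected V S u v)) V) V)

-- acyclic: no edge lies on a cycle, i.e. removing any edge {u,v} of S
-- leaves u and v disconnected
acyclic : List ℕ → List Edge → Bool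
acyclic V S = all (λ { ((u , v) , R) → not (connected V R u v) }) (picks S)

isSpanningTree : ℕ → List Edge → Bool
isSpanningTree n S = acyclic (wheelVertices n) S ∧ (components (wheelVertices n) S ≡ᵇ 1)

spanningTreeCount : ℕ → ℕ
spanningTreeCount n = length (filterᵇ (isSpanningTree n) (sublists (wheelEdges n)))

isSeparatingTwoForest : ℕ → ℕ → ℕ → List Edge → Bool
isSeparatingTwoForest n i j S =
  acyclic (wheelVertices n) S ∧ (components (wheelVertices n) S ≡ᵇ 2)
  ∧ not (connected (wheelVertices n) S i j)

twoForestCount : ℕ → ℕ → ℕ → ℕ
twoForestCount n i j = length (filterᵇ (isSeparatingTwoForest n i j) (sublists (wheelEdges n)))

-- Scan the rim cyclically from v_i, adding with each new rim vertex its spoke and its rim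
-- edge to the previous one, and finally the rim edge back to v_i. A counted edge set has at
-- most two components, so at every stage each component of a partial edge set must contain
-- one of four tracked vertices: the centre, v_i, the last scanned vertex and v_j (the centre
-- until v_j is scanned). A partial edge set is therefore described by the connectivity among
-- the tracked vertices, one of 15 patterns, or it is dead. The numbers of edge sets in each
-- state satisfy a linear recurrence, checked on the finitely many patterns and solved in the
-- basis 1, f_{2L}, f_{2L+1} − 1. This gives T(W_{n+1}) = ℓ_{2n} − 2 and
-- F(v_i | v_j) + 2 f_{2d} + 2 f_{2(n−d)} = 2 f_{2n} for the rim distance d, from which the
-- formula follows by d'Ocagne's identity.

module Submission where

open import Defs
open import Algebra.Bundles using (CommutativeMonoid)
import Algebra.Properties.CommutativeSemigroup as CommutativeSemigroupProperties
open import Data.Bool using (Bool; true; false; _∧_; _∨_; not; if_then_else_)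
open import Data.Bool.ListAction using (any; all)
open import Data.Bool.Properties
  using (T-≡; ¬-not; ∧-conicalˡ; ∧-conicalʳ; ∧-zeroʳ; ∨-identityʳ; ∨-commutativeMonoid; ∧-commutativeMonoid)
open import Data.Empty using (⊥; ⊥-elim)
open import Data.List using (List; []; _∷_; _++_; map; length; filterᵇ; upTo; applyUpTo)
open import Data.List.Membership.Propositional using (_∈_)
open import Data.List.Membership.Propositional.Properties using (∈-map⁻; ∈-++⁻; ∈-upTo⁺)
open import Data.List.Properties
  using (length-filter; map-++; map-∘; map-cong; ++-assoc; map-applyUpTo; length-applyUpTo)
open import Data.List.Relation.Binary.Permutation.Propositional as ↭
  using (_↭_; prep; swap; ↭-sym; ↭-trans; ↭-refl)
open import Data.List.Relation.Binary.Permutation.Propositional.Properties using (++-comm; ++⁺; shift; ∷↭∷ʳ)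
open import Data.List.Relation.Unary.All using (All; _∷_)
open import Data.List.Relation.Unary.AllPairs using (_∷_)
open import Data.List.Relation.Unary.Any using (here; there)
open import Data.List.Relation.Unary.Unique.Propositional using (Unique)
open import Data.List.Relation.Unary.Unique.Propositional.Properties using (upTo⁺)
open import Data.Nat using (ℕ; zero; suc; _+_; _*_; _∸_; _⊓_; ∣_-_∣; _≡ᵇ_; _<ᵇ_; _≤ᵇ_; _≤_; _<_; z≤n; s≤s; _≤?_; _<?_)
open import Data.Nat.ListAction using (sum)
open import Data.Nat.ListAction.Properties using (sum-++)
open import Data.Nat.Properties
open import Data.Nat.Solver using (module +-*-Solver)
open import Data.Product using (_×_; _,_; proj₁; proj₂; Σ-syntax)
open import Data.Sum using (_⊎_; inj₁; inj₂)
open import Function using (id; _∘_; _∘′_; Equivalence)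
open import Relation.Binary.Definitions using (tri<; tri≈; tri>)
open import Relation.Binary.PropositionalEquality
open import Relation.Nullary using (¬_; yes; no)

open +-*-Solver using (solve; _:+_; _:*_; _:=_; con)
open ≡-Reasoning
open CommutativeSemigroupProperties +-commutativeSemigroup
  using () renaming (interchange to +-interchange; xy∙z≈xz∙y to +-swapʳ)
open CommutativeSemigroupProperties (CommutativeMonoid.commutativeSemigroup ∨-commutativeMonoid)
  using () renaming (x∙yz≈y∙xz to ∨-exchange)
open CommutativeSemigroupProperties (CommutativeMonoid.commutativeSemigroup ∧-commutativeMonoid)
  using () renaming (x∙yz≈y∙xz to ∧-exchange)

∨-introˡ : ∀ {a} b → a ≡ true → a ∨ b ≡ true
∨-introˡ b refl = refl

∨-introʳ : ∀ a {b} → b ≡ true → a ∨ b ≡ true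
∨-introʳ true refl = refl
∨-introʳ false refl = refl

∨-elim : ∀ a {b} → a ∨ b ≡ true → a ≡ true ⊎ b ≡ true
∨-elim true _ = inj₁ refl
∨-elim false e = inj₂ e

∧-intro : ∀ {a b} → a ≡ true → b ≡ true → a ∧ b ≡ true
∧-intro refl refl = refl

true≢false : ∀ {a} → a ≡ true → a ≡ false → ⊥
true≢false refl ()

bool-ext : ∀ {a b : Bool} → (a ≡ true → b ≡ true) → (b ≡ true → a ≡ true) → a ≡ b
bool-ext {true} f _ = sym (f refl)
bool-ext {false} {true} _ g = g refl
bool-ext {false} {false} _ _ = refl

≡ᵇ⇒≡′ : ∀ {m n} → (m ≡ᵇ n) ≡ true → m ≡ n
≡ᵇ⇒≡′ {m} {n} e = ≡ᵇ⇒≡ m n (Equivalence.from T-≡ e)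

≡ᵇ-refl : ∀ m → (m ≡ᵇ m) ≡ true
≡ᵇ-refl m = Equivalence.to T-≡ (≡⇒≡ᵇ m m refl)

≢⇒≡ᵇ-false : ∀ {m n} → m ≢ n → (m ≡ᵇ n) ≡ false
≢⇒≡ᵇ-false h = ¬-not (h ∘ ≡ᵇ⇒≡′)

<ᵇ⇒<′ : ∀ {m n} → (m <ᵇ n) ≡ true → m < n
<ᵇ⇒<′ {m} {n} e = <ᵇ⇒< m n (Equivalence.from T-≡ e)

<⇒<ᵇ′ : ∀ {m n} → m < n → (m <ᵇ n) ≡ true
<⇒<ᵇ′ lt = Equivalence.to T-≡ (<⇒<ᵇ lt)

≥⇒<ᵇ-false : ∀ {m n} → n ≤ m → (m <ᵇ n) ≡ false
≥⇒<ᵇ-false le = ¬-not λ e → <⇒≱ (<ᵇ⇒<′ e) le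

≤ᵇ⇒≤′ : ∀ {m n} → (m ≤ᵇ n) ≡ true → m ≤ n
≤ᵇ⇒≤′ {m} {n} e = ≤ᵇ⇒≤ m n (Equivalence.from T-≡ e)

≤⇒≤ᵇ′ : ∀ {m n} → m ≤ n → (m ≤ᵇ n) ≡ true
≤⇒≤ᵇ′ le = Equivalence.to T-≡ (≤⇒≤ᵇ le)

>⇒≤ᵇ-false : ∀ {m n} → n < m → (m ≤ᵇ n) ≡ false
>⇒≤ᵇ-false lt = ¬-not λ e → <⇒≱ lt (≤ᵇ⇒≤′ e)

any-elim : ∀ {A : Set} (p : A → Bool) xs → any p xs ≡ true → Σ[ x ∈ A ] x ∈ xs × p x ≡ true
any-elim p (x ∷ xs) e with p x in eq
... | true = x , here refl , eq
... | false with any-elim p xs e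
... | y , y∈xs , py = y , there y∈xs , py

any-intro : ∀ {A : Set} (p : A → Bool) {x} xs → x ∈ xs → p x ≡ true → any p xs ≡ true
any-intro p (y ∷ xs) (here refl) px = ∨-introˡ (any p xs) px
any-intro p (y ∷ xs) (there x∈xs) px = ∨-introʳ (p y) (any-intro p xs x∈xs px)

all-elim : ∀ {A : Set} (p : A → Bool) {x} xs → all p xs ≡ true → x ∈ xs → p x ≡ true
all-elim p (y ∷ xs) e (here refl) = ∧-conicalˡ _ _ e
all-elim p (y ∷ xs) e (there x∈xs) = all-elim p xs (∧-conicalʳ (p y) _ e) x∈xs

all-intro : ∀ {A : Set} (p : A → Bool) xs → (∀ {x} → x ∈ xs → p x ≡ true) → all p xs ≡ true
all-intro p [] h = refl
all-intro p (y ∷ xs) h = ∧-intro (h (here refl)) (all-intro p xs (h ∘ there))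

all-false : ∀ {A : Set} (p : A → Bool) xs → all p xs ≢ true → Σ[ x ∈ A ] x ∈ xs × p x ≡ false
all-false p [] h = ⊥-elim (h refl)
all-false p (y ∷ xs) h with p y in eq
... | false = y , here refl , eq
... | true with all-false p xs h
... | z , z∈xs , pz = z , there z∈xs , pz

all-cong : ∀ {A : Set} (p q : A → Bool) xs → (∀ {x} → x ∈ xs → p x ≡ q x) → all p xs ≡ all q xs
all-cong p q [] h = refl
all-cong p q (y ∷ xs) h = cong₂ _∧_ (h (here refl)) (all-cong p q xs (h ∘ there))

any-cong : ∀ {A : Set} (p q : A → Bool) xs → (∀ {x} → x ∈ xs → p x ≡ q x) → any p xs ≡ any q xs
any-cong p q [] h = refl
any-cong p q (y ∷ xs) h = cong₂ _∨_ (h (here refl)) (any-cong p q xs (h ∘ there))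

filterᵇ-cong : ∀ {A : Set} (p q : A → Bool) xs → (∀ {x} → x ∈ xs → p x ≡ q x) → filterᵇ p xs ≡ filterᵇ q xs
filterᵇ-cong p q [] h = refl
filterᵇ-cong p q (y ∷ xs) h with p y | q y | h (here refl)
... | true | true | _ = cong (y ∷_) (filterᵇ-cong p q xs (h ∘ there))
... | false | false | _ = filterᵇ-cong p q xs (h ∘ there)

∉-all : ∀ {x} {ys : List ℕ} → All (x ≢_) ys → x ∈ ys → ⊥
∉-all (px ∷ _) (here refl) = px refl
∉-all (_ ∷ a) (there m) = ∉-all a m

length-filterᵇ-one-more : ∀ (p q : ℕ → Bool) xs → Unique xs → ∀ {w} → w ∈ xs → p w ≡ true → q w ≡ false →
  (∀ {x} → x ∈ xs → x ≢ w → p x ≡ q x) → length (filterᵇ p xs) ≡ suc (length (filterᵇ q xs))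
length-filterᵇ-one-more p q (y ∷ xs) (x∉xs ∷ un) (here refl) pw qw h rewrite pw | qw =
  cong (suc ∘ length) (filterᵇ-cong p q xs (λ m → h (there m) (λ { refl → ∉-all x∉xs m })))
length-filterᵇ-one-more p q (y ∷ xs) (x∉xs ∷ un) (there m) pw qw h
  with p y | q y | h (here refl) (λ { refl → ∉-all x∉xs m })
... | true | true | _ = cong suc (length-filterᵇ-one-more p q xs un m pw qw (h ∘ there))
... | false | false | _ = length-filterᵇ-one-more p q xs un m pw qw (h ∘ there)

filterᵇ-mono : ∀ (p q : ℕ → Bool) xs → (∀ {x} → x ∈ xs → p x ≡ true → q x ≡ true) →
  length (filterᵇ p xs) ≤ length (filterᵇ q xs)
filterᵇ-mono p q [] h = z≤n
filterᵇ-mono p q (y ∷ xs) h with p y in ep | q y in eq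
... | true | true = s≤s (filterᵇ-mono p q xs (h ∘ there))
... | true | false = ⊥-elim (true≢false (h (here refl) ep) eq)
... | false | true = m≤n⇒m≤1+n (filterᵇ-mono p q xs (h ∘ there))
... | false | false = filterᵇ-mono p q xs (h ∘ there)

filterᵇ-strict : ∀ (p q : ℕ → Bool) xs → (∀ {x} → x ∈ xs → p x ≡ true → q x ≡ true) →
  ∀ {z} → z ∈ xs → p z ≡ false → q z ≡ true → length (filterᵇ p xs) < length (filterᵇ q xs)
filterᵇ-strict p q (y ∷ xs) h (here refl) pz qz rewrite pz | qz = s≤s (filterᵇ-mono p q xs (h ∘ there))
filterᵇ-strict p q (y ∷ xs) h (there z∈xs) pz qz with p y in ep | q y in eq
... | true | true = s≤s (filterᵇ-strict p q xs (h ∘ there) z∈xs pz qz)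
... | true | false = ⊥-elim (true≢false (h (here refl) ep) eq)
... | false | true = m≤n⇒m≤1+n (filterᵇ-strict p q xs (h ∘ there) z∈xs pz qz)
... | false | false = filterᵇ-strict p q xs (h ∘ there) z∈xs pz qz

-- Walks, connectivity and components

Ends : Edge → ℕ → ℕ → Set
Ends e a b = e ≡ (a , b) ⊎ e ≡ (b , a)

Ends-sym : ∀ {e a b} → Ends e a b → Ends e b a
Ends-sym (inj₁ x) = inj₂ x
Ends-sym (inj₂ y) = inj₁ y

joins : ℕ → ℕ → Edge → Bool
joins u v (a , b) = ((a ≡ᵇ u) ∧ (b ≡ᵇ v)) ∨ ((a ≡ᵇ v) ∧ (b ≡ᵇ u))

adj-any : ∀ S u v → adj S u v ≡ any (joins u v) S
adj-any [] u v = refl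
adj-any ((a , b) ∷ S) u v = cong (_ ∨_) (adj-any S u v)

joins⇒Ends : ∀ u v e → joins u v e ≡ true → Ends e u v
joins⇒Ends u v (a , b) h with ∨-elim ((a ≡ᵇ u) ∧ (b ≡ᵇ v)) h
... | inj₁ x = inj₁ (cong₂ _,_ (≡ᵇ⇒≡′ (∧-conicalˡ _ _ x)) (≡ᵇ⇒≡′ (∧-conicalʳ _ _ x)))
... | inj₂ x = inj₂ (cong₂ _,_ (≡ᵇ⇒≡′ (∧-conicalˡ _ _ x)) (≡ᵇ⇒≡′ (∧-conicalʳ _ _ x)))

Ends⇒joins : ∀ u v e → Ends e u v → joins u v e ≡ true
Ends⇒joins u v _ (inj₁ refl) rewrite ≡ᵇ-refl u | ≡ᵇ-refl v = refl
Ends⇒joins u v _ (inj₂ refl) rewrite ≡ᵇ-refl u | ≡ᵇ-refl v = ∨-introʳ ((v ≡ᵇ u) ∧ (u ≡ᵇ v)) refl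

adj⇒edge : ∀ S u v → adj S u v ≡ true → Σ[ e ∈ Edge ] e ∈ S × Ends e u v
adj⇒edge S u v h with any-elim (joins u v) S (trans (sym (adj-any S u v)) h)
... | e , e∈S , j = e , e∈S , joins⇒Ends u v e j

edge⇒adj : ∀ S u v e → e ∈ S → Ends e u v → adj S u v ≡ true
edge⇒adj S u v e e∈S en = trans (adj-any S u v) (any-intro (joins u v) S e∈S (Ends⇒joins u v e en))

adj-sym : ∀ S u v → adj S u v ≡ true → adj S v u ≡ true
adj-sym S u v h with adj⇒edge S u v h
... | e , e∈S , en = edge⇒adj S v u e e∈S (Ends-sym en)

_⊆_ : List Edge → List Edge → Set
S ⊆ S′ = ∀ {e} → e ∈ S → e ∈ S′

adj-mono : ∀ {S S′} → S ⊆ S′ → ∀ u v → adj S u v ≡ true → adj S′ u v ≡ true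
adj-mono {S} {S′} sub u v a with adj⇒edge S u v a
... | e , e∈S , en = edge⇒adj S′ u v e (sub e∈S) en

data Path (S : List Edge) (u : ℕ) : ℕ → Set where
  [] : Path S u u
  _▷_ : ∀ {w v} → Path S u w → adj S w v ≡ true → Path S u v

infixl 5 _▷_ _++ₚ_

_++ₚ_ : ∀ {S u w v} → Path S u w → Path S w v → Path S u v
p ++ₚ [] = p
p ++ₚ (q ▷ a) = (p ++ₚ q) ▷ a

edge-path : ∀ {S a b} → (a , b) ∈ S → Path S a b
edge-path {S} {a} {b} ab∈S = [] ▷ edge⇒adj S a b (a , b) ab∈S (inj₁ refl)

reverse : ∀ {S u v} → Path S u v → Path S v u
reverse [] = []
reverse {S} (_▷_ {w} {v} p a) = ([] ▷ adj-sym S w v a) ++ₚ reverse p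

path-mono : ∀ {S S′ u v} → S ⊆ S′ → Path S u v → Path S′ u v
path-mono sub [] = []
path-mono sub (_▷_ {w} {v} p a) = path-mono sub p ▷ adj-mono sub w v a

PathVia : List Edge → ℕ → ℕ → ℕ → ℕ → Set
PathVia S u v a b = Path S a b ⊎ (Path S a u × Path S v b) ⊎ (Path S a v × Path S u b)

-- A walk using the new edge uv can be cut at its last use of uv.
path-∷ : ∀ {S u v a b} → Path ((u , v) ∷ S) a b → PathVia S u v a b
path-∷ [] = inj₁ []
path-∷ {S} {u} {v} {a} (_▷_ {w} {b} p ad) with path-∷ p | ∨-elim (joins w b (u , v)) ad
... | ih | inj₂ adS = extend ih
  where
  extend : PathVia S u v a w → PathVia S u v a b
  extend (inj₁ q) = inj₁ (q ▷ adS)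
  extend (inj₂ (inj₁ (q , r))) = inj₂ (inj₁ (q , r ▷ adS))
  extend (inj₂ (inj₂ (q , r))) = inj₂ (inj₂ (q , r ▷ adS))
... | ih | inj₁ uv with joins⇒Ends w b (u , v) uv
... | inj₁ refl = forward ih
  where
  forward : PathVia S w b a w → PathVia S w b a b
  forward (inj₁ q) = inj₂ (inj₁ (q , []))
  forward (inj₂ (inj₁ (q , _))) = inj₂ (inj₁ (q , []))
  forward (inj₂ (inj₂ (q , _))) = inj₁ q
... | inj₂ refl = backward ih
  where
  backward : PathVia S b w a w → PathVia S b w a b
  backward (inj₁ q) = inj₂ (inj₂ (q , []))
  backward (inj₂ (inj₁ (q , _))) = inj₁ q
  backward (inj₂ (inj₂ (q , _))) = inj₂ (inj₂ (q , []))

Isolated : ℕ → List Edge → Set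
Isolated z S = ∀ {e} → e ∈ S → proj₁ e ≢ z × proj₂ e ≢ z

path-to-isolated : ∀ {S u z} → Isolated z S → Path S u z → u ≡ z
path-to-isolated iso [] = refl
path-to-isolated {S} {z = z} iso (_▷_ {w} p a) with adj⇒edge S w z a
... | _ , e∈S , inj₁ refl = ⊥-elim (proj₂ (iso e∈S) refl)
... | _ , e∈S , inj₂ refl = ⊥-elim (proj₁ (iso e∈S) refl)

Closed : List ℕ → List Edge → Set
Closed V S = ∀ {e} → e ∈ S → proj₁ e ∈ V × proj₂ e ∈ V

reachK⇒Path : ∀ k V S u v → reachK k V S u v ≡ true → Path S u v
reachK⇒Path zero V S u v h rewrite ≡ᵇ⇒≡′ {u} {v} h = []
reachK⇒Path (suc k) V S u v h with ∨-elim (reachK k V S u v) h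
... | inj₁ x = reachK⇒Path k V S u v x
... | inj₂ x with any-elim (λ w → reachK k V S u w ∧ adj S w v) V x
... | w , _ , pw = reachK⇒Path k V S u w (∧-conicalˡ _ _ pw) ▷ ∧-conicalʳ _ _ pw

adj-source∈ : ∀ {V S} → Closed V S → ∀ w v → adj S w v ≡ true → w ∈ V
adj-source∈ {V} {S} cl w v a with adj⇒edge S w v a
... | _ , e∈S , inj₁ refl = proj₁ (cl e∈S)
... | _ , e∈S , inj₂ refl = proj₂ (cl e∈S)

Path⇒reachK : ∀ {V S u v} → Closed V S → Path S u v → Σ[ k ∈ ℕ ] reachK k V S u v ≡ true
Path⇒reachK {u = u} cl [] = zero , ≡ᵇ-refl u
Path⇒reachK {V} {S} {u} cl (_▷_ {w} {v} p a) with Path⇒reachK cl p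
... | k , r = suc k , ∨-introʳ (reachK k V S u v)
  (any-intro (λ x → reachK k V S u x ∧ adj S x v) V (adj-source∈ cl w v a) (∧-intro r a))

-- The reachable sets grow with k, and strictly only while the number of reachable
-- vertices of V increases; so they are stable from some k ≤ |V| on.
module Saturation (V : List ℕ) (S : List Edge) (u : ℕ) where

  R : ℕ → ℕ → Bool
  R k v = reachK k V S u v

  R-mono : ∀ {k k′} v → k ≤ k′ → R k v ≡ true → R k′ v ≡ true
  R-mono {k} {k′} v le h = subst (λ x → R x v ≡ true) (m∸n+n≡m le) (go (k′ ∸ k))
    where
    go : ∀ j → R (j + k) v ≡ true
    go zero = h
    go (suc j) = ∨-introˡ _ (go j)

  settled : ℕ → ℕ → Bool
  settled k w = not (R (suc k) w) ∨ R k w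

  Stable : ℕ → Set
  Stable k = all (settled k) V ≡ true

  stable-use : ∀ {k w} → Stable k → w ∈ V → R (suc k) w ≡ true → R k w ≡ true
  stable-use {k} {w} st w∈V h with all-elim (settled k) V st w∈V
  ... | e rewrite h = e

  stable-suc : ∀ k → Stable k → Stable (suc k)
  stable-suc k st = all-intro (settled (suc k)) V λ {w} _ → settles w
    where
    next : ∀ v → R (suc (suc k)) v ≡ true → R (suc k) v ≡ true
    next v h with ∨-elim (R (suc k) v) h
    ... | inj₁ x = x
    ... | inj₂ x with any-elim (λ w → R (suc k) w ∧ adj S w v) V x
    ... | w , w∈V , pw = ∨-introʳ (R k v) (any-intro (λ x → R k x ∧ adj S x v) V w∈V
                           (∧-intro (stable-use {k} st w∈V (∧-conicalˡ _ _ pw)) (∧-conicalʳ _ _ pw)))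
    settles : ∀ w → settled (suc k) w ≡ true
    settles w with R (suc (suc k)) w in eq
    ... | false = refl
    ... | true rewrite next w eq = refl

  stable-down : ∀ j k v → Stable k → v ∈ V → R (j + k) v ≡ true → R k v ≡ true
  stable-down zero k v st v∈V h = h
  stable-down (suc j) k v st v∈V h =
    stable-down j k v st v∈V (stable-use {j + k} (stable+ j) v∈V h)
    where
    stable+ : ∀ j → Stable (j + k)
    stable+ zero = st
    stable+ (suc j) = stable-suc (j + k) (stable+ j)

  reached : ℕ → ℕ
  reached k = length (filterᵇ (R k) V)

  growing-or-stable : ∀ k → k ≤ reached k ⊎ Σ[ k′ ∈ ℕ ] k′ < k × Stable k′
  growing-or-stable zero = inj₁ z≤n
  growing-or-stable (suc k) with growing-or-stable k
  ... | inj₂ (k′ , lt , st) = inj₂ (k′ , m≤n⇒m≤1+n lt , st)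
  ... | inj₁ le with all (settled k) V in es
  ... | true = inj₂ (k , n<1+n k , es)
  ... | false with all-false (settled k) V (λ e → true≢false e es)
  ... | w , w∈V , sw = inj₁ (≤-trans (s≤s le)
          (filterᵇ-strict (R k) (R (suc k)) V (λ _ h → ∨-introˡ _ h) w∈V (proj₁ (unsettled sw)) (proj₂ (unsettled sw))))
    where
    not-or-false : ∀ a b → not a ∨ b ≡ false → b ≡ false × a ≡ true
    not-or-false true false _ = refl , refl
    unsettled : settled k w ≡ false → R k w ≡ false × R (suc k) w ≡ true
    unsettled = not-or-false (R (suc k) w) (R k w)

  stable-exists : Σ[ k′ ∈ ℕ ] k′ ≤ length V × Stable k′
  stable-exists with growing-or-stable (suc (length V))
  ... | inj₁ le = ⊥-elim (<-irrefl refl (≤-trans le (length-filter _ V)))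
  ... | inj₂ (k′ , lt , st) = k′ , ≤-pred lt , st

  saturate : ∀ k v → v ∈ V → R k v ≡ true → R (length V) v ≡ true
  saturate k v v∈V h with stable-exists
  ... | k′ , le , st with k ≤? k′
  ... | yes k≤k′ = R-mono v (≤-trans k≤k′ le) h
  ... | no k≰k′ = R-mono v le (stable-down (k ∸ k′) k′ v st v∈V
                    (subst (λ x → R x v ≡ true) (sym (m∸n+n≡m (<⇒≤ (≰⇒> k≰k′)))) h))

connected⇒Path : ∀ V S u v → connected V S u v ≡ true → Path S u v
connected⇒Path V S u v = reachK⇒Path (length V) V S u v

Path⇒connected : ∀ {V S u v} → Closed V S → v ∈ V → Path S u v → connected V S u v ≡ true
Path⇒connected {V} {S} {u} {v} cl v∈V p with Path⇒reachK cl p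
... | k , r = Saturation.saturate V S u k v v∈V r

link : {A : Set} → A → A → (A → A → Bool) → A → A → Bool
link u v c x y = c x y ∨ ((c x u ∧ c v y) ∨ (c x v ∧ c u y))

link⇒Path : ∀ V S {S′ u v a b} → S ⊆ S′ → Path S′ u v → link u v (connected V S) a b ≡ true → Path S′ a b
link⇒Path V S {S′} {u} {v} {a} {b} sub uv h = direct-or-through (∨-elim (c a b) h)
  where
  c : ℕ → ℕ → Bool
  c = connected V S
  lift : ∀ {x y} → c x y ≡ true → Path S′ x y
  lift = path-mono sub ∘ connected⇒Path V S _ _
  through : (c a u ∧ c v b) ≡ true ⊎ (c a v ∧ c u b) ≡ true → Path S′ a b
  through (inj₁ k) = lift (∧-conicalˡ _ _ k) ++ₚ uv ++ₚ lift (∧-conicalʳ _ _ k)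
  through (inj₂ k) = lift (∧-conicalˡ _ _ k) ++ₚ reverse uv ++ₚ lift (∧-conicalʳ _ _ k)
  direct-or-through : c a b ≡ true ⊎ ((c a u ∧ c v b) ∨ (c a v ∧ c u b)) ≡ true → Path S′ a b
  direct-or-through (inj₁ h₁) = lift h₁
  direct-or-through (inj₂ h₂) = through (∨-elim (c a u ∧ c v b) h₂)

connected-∷ : ∀ V S u v x y → Closed V ((u , v) ∷ S) → x ∈ V → y ∈ V →
  connected V ((u , v) ∷ S) x y ≡ link u v (connected V S) x y
connected-∷ V S u v x y cl x∈V y∈V = bool-ext split (Path⇒connected cl y∈V ∘ link⇒Path V S there (edge-path (here refl)))
  where
  clS : Closed V S
  clS = cl ∘ there
  c : ℕ → ℕ → Bool
  c = connected V S
  split : connected V ((u , v) ∷ S) x y ≡ true → link u v c x y ≡ true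
  split h with path-∷ (connected⇒Path V ((u , v) ∷ S) x y h)
  ... | inj₁ p = ∨-introˡ _ (Path⇒connected clS y∈V p)
  ... | inj₂ (inj₁ (p , q)) = ∨-introʳ (c x y) (∨-introˡ _ (∧-intro (Path⇒connected clS (proj₁ (cl (here refl))) p) (Path⇒connected clS y∈V q)))
  ... | inj₂ (inj₂ (p , q)) = ∨-introʳ (c x y) (∨-introʳ (c x u ∧ c v y) (∧-intro (Path⇒connected clS (proj₂ (cl (here refl))) p) (Path⇒connected clS y∈V q)))

picks-⊆ : ∀ (S : List Edge) {y R} → (y , R) ∈ picks S → y ∈ S × R ⊆ S
picks-⊆ (x ∷ xs) (here refl) = here refl , there
picks-⊆ (x ∷ xs) (there m) with ∈-map⁻ _ m
... | (y , R) , m′ , refl with picks-⊆ xs m′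
... | y∈xs , R⊆xs = there y∈xs , λ { (here refl) → here refl ; (there k) → there (R⊆xs k) }

all-map : ∀ {A B : Set} (f : B → Bool) (g : A → B) xs → all f (map g xs) ≡ all (f ∘ g) xs
all-map f g [] = refl
all-map f g (x ∷ xs) = cong (f (g x) ∧_) (all-map f g xs)

cutFree : List ℕ → Edge × List Edge → Bool
cutFree V ((u , v) , R) = not (connected V R u v)

-- If uv is a bridge, removing another edge ab of S cannot be repaired through uv,
-- since a path through uv would give a path u → v in S.
acyclic-∷ : ∀ V S u v → Closed V ((u , v) ∷ S) →
  acyclic V ((u , v) ∷ S) ≡ not (connected V S u v) ∧ acyclic V S
acyclic-∷ V S u v cl with connected V S u v in uv-connected
... | true = refl
... | false = trans (all-map (cutFree V) (λ { (y , ys) → y , (u , v) ∷ ys }) (picks S)) (all-cong _ _ (picks S) same)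
  where
  clS : Closed V S
  clS = cl ∘ there
  no-uv : ¬ Path S u v
  no-uv p = true≢false (Path⇒connected clS (proj₂ (cl (here refl))) p) uv-connected
  same : ∀ {z} → z ∈ picks S → cutFree V (proj₁ z , (u , v) ∷ proj₂ z) ≡ cutFree V z
  same {(a , b) , R} m with picks-⊆ S m
  ... | ab∈S , R⊆S = cong not (trans (connected-∷ V R u v a b clR (proj₁ (clS ab∈S)) (proj₂ (clS ab∈S))) no-detour)
    where
    clR : Closed V ((u , v) ∷ R)
    clR (here refl) = cl (here refl)
    clR (there k) = clS (R⊆S k)
    c : ℕ → ℕ → Bool
    c = connected V R
    inS : ∀ x y → c x y ≡ true → Path S x y
    inS x y h = path-mono R⊆S (connected⇒Path V R x y h)
    forward : (c a u ∧ c v b) ≡ false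
    forward = ¬-not λ h → no-uv (reverse (inS a u (∧-conicalˡ _ _ h)) ++ₚ edge-path ab∈S ++ₚ reverse (inS v b (∧-conicalʳ _ _ h)))
    backward : (c a v ∧ c u b) ≡ false
    backward = ¬-not λ h → no-uv (inS u b (∧-conicalʳ _ _ h) ++ₚ reverse (edge-path ab∈S) ++ₚ inS a v (∧-conicalˡ _ _ h))
    no-detour : link u v c a b ≡ c a b
    no-detour rewrite forward | backward with c a b
    ... | true = refl
    ... | false = refl

module Components (V : List ℕ) (uniq : Unique V) where

  isRoot : List Edge → ℕ → Bool
  isRoot S v = all (λ u → not ((u <ᵇ v) ∧ connected V S u v)) V

  root-least : ∀ {S r x} → Closed V S → r ∈ V → isRoot S r ≡ true → x ∈ V → x < r → ¬ Path S x r
  root-least {S} {r} {x} cl r∈V h x∈V lt p with all-elim (λ u → not ((u <ᵇ r) ∧ connected V S u r)) V h x∈V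
  ... | e rewrite <⇒<ᵇ′ lt | Path⇒connected cl r∈V p = true≢false e refl

  root-unique : ∀ {S r₁ r₂} → Closed V S → r₁ ∈ V → r₂ ∈ V → isRoot S r₁ ≡ true → isRoot S r₂ ≡ true →
    Path S r₁ r₂ → r₁ ≡ r₂
  root-unique cl r₁∈V r₂∈V h₁ h₂ p with <-cmp _ _
  ... | tri< lt _ _ = ⊥-elim (root-least cl r₂∈V h₂ r₁∈V lt p)
  ... | tri≈ _ eq _ = eq
  ... | tri> _ _ gt = ⊥-elim (root-least cl r₁∈V h₁ r₂∈V gt (reverse p))

  root-exists : ∀ {S} → Closed V S → ∀ v → v ∈ V → Σ[ r ∈ ℕ ] r ∈ V × Path S r v × isRoot S r ≡ true
  root-exists {S} cl v v∈V = go (suc v) v ≤-refl v∈V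
    where
    go : ∀ b v → v < b → v ∈ V → Σ[ r ∈ ℕ ] r ∈ V × Path S r v × isRoot S r ≡ true
    go (suc b) v lt v∈V with isRoot S v in eq
    ... | true = v , v∈V , [] , eq
    ... | false with all-false (λ u → not ((u <ᵇ v) ∧ connected V S u v)) V (λ e → true≢false e eq)
    ... | x , x∈V , fx with not-false fx
      where
      not-false : ∀ {a} → not a ≡ false → a ≡ true
      not-false {true} _ = refl
    ... | h with go b x (≤-trans (<ᵇ⇒<′ (∧-conicalˡ _ _ h)) (≤-pred lt)) x∈V
    ... | r , r∈V , p , isr = r , r∈V , p ++ₚ connected⇒Path V S x v (∧-conicalʳ _ _ h) , isr

  root-mono : ∀ {S E} → S ⊆ E → Closed V E → ∀ x → x ∈ V → isRoot E x ≡ true → isRoot S x ≡ true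
  root-mono {S} {E} sub clE x x∈V r = all-intro _ V λ {y} y∈V → step y (all-elim _ V r y∈V)
    where
    step : ∀ y → not ((y <ᵇ x) ∧ connected V E y x) ≡ true → not ((y <ᵇ x) ∧ connected V S y x) ≡ true
    step y e with y <ᵇ x | connected V S y x in c
    ... | false | _ = refl
    ... | true | false = refl
    ... | true | true rewrite Path⇒connected clE x∈V (path-mono sub (connected⇒Path V S y x c)) = e

  components-∷-connected : ∀ S u v → Closed V ((u , v) ∷ S) → connected V S u v ≡ true →
    components V ((u , v) ∷ S) ≡ components V S
  components-∷-connected S u v cl c = cong length (filterᵇ-cong _ _ V λ {x} x∈V →
      all-cong _ _ V λ {y} y∈V → cong (λ b → not ((y <ᵇ x) ∧ b)) (same y x y∈V x∈V))
    where
    same : ∀ a b → a ∈ V → b ∈ V → connected V ((u , v) ∷ S) a b ≡ connected V S a b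
    same a b a∈V b∈V = trans (connected-∷ V S u v a b cl a∈V b∈V)
      (bool-ext (Path⇒connected (cl ∘ there) b∈V ∘ link⇒Path V S (λ e∈S → e∈S) (connected⇒Path V S u v c)) (∨-introˡ _))

  -- Joining the components of p and q, with roots ra < rb: rb stops being a root and
  -- every other root stays one.
  merge-roots : ∀ {S E} p q ra rb → S ⊆ E → Closed V E → ra ∈ V → rb ∈ V → Path S ra p → Path S rb q →
    isRoot S ra ≡ true → isRoot S rb ≡ true → ra < rb → Path E ra rb →
    (∀ {y x} → Path E y x → PathVia S p q y x) → components V S ≡ suc (components V E)
  merge-roots {S} {E} p q ra rb S⊆E clE ra∈V rb∈V pa pb ha hb lt pab via =
    length-filterᵇ-one-more (isRoot S) (isRoot E) V uniq rb∈V hb rb-not-root λ {x} x∈V x≢rb →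
      bool-ext (λ r → stays x x∈V r x≢rb) (root-mono S⊆E clE x x∈V)
    where
    clS : Closed V S
    clS = clE ∘ S⊆E
    rb-not-root : isRoot E rb ≡ false
    rb-not-root = ¬-not λ h → root-least clE rb∈V h ra∈V lt pab
    stays : ∀ x → x ∈ V → isRoot S x ≡ true → x ≢ rb → isRoot E x ≡ true
    stays x x∈V hx x≢rb = all-intro _ V λ {y} y∈V → no-smaller y y∈V
      where
      no-smaller : ∀ y → y ∈ V → not ((y <ᵇ x) ∧ connected V E y x) ≡ true
      no-smaller y y∈V with y <ᵇ x in y<x | connected V E y x in ce
      ... | false | _ = refl
      ... | true | false = refl
      ... | true | true with via (connected⇒Path V E y x ce)
      ... | inj₁ pyx = ⊥-elim (root-least clS x∈V hx y∈V (<ᵇ⇒<′ y<x) pyx)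
      ... | inj₂ (inj₁ (_ , pqx)) = ⊥-elim (x≢rb (sym (root-unique clS rb∈V x∈V hb hx (pb ++ₚ pqx))))
      ... | inj₂ (inj₂ (pyq , ppx)) with root-unique clS ra∈V x∈V ha hx (pa ++ₚ ppx)
      ... | refl = ⊥-elim (<-irrefl refl (<-trans (≤-<-trans rb≤y (<ᵇ⇒<′ y<x)) lt))
        where
        rb≤y : rb ≤ y
        rb≤y = ≮⇒≥ (λ y<rb → root-least clS rb∈V hb y∈V y<rb (pyq ++ₚ reverse pb))

  components-∷-disconnected : ∀ S u v → Closed V ((u , v) ∷ S) → connected V S u v ≡ false →
    components V S ≡ suc (components V ((u , v) ∷ S))
  components-∷-disconnected S u v cl nc
    with root-exists clS u (proj₁ (cl (here refl))) | root-exists clS v (proj₂ (cl (here refl)))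
    where
    clS : Closed V S
    clS = cl ∘ there
  ... | ru , ru∈V , pu , hu | rv , rv∈V , pv , hv with <-cmp ru rv
  ... | tri< lt _ _ = merge-roots u v ru rv there cl ru∈V rv∈V pu pv hu hv lt
                        (lift pu ++ₚ uv ++ₚ reverse (lift pv)) path-∷
    where
    lift : ∀ {a b} → Path S a b → Path ((u , v) ∷ S) a b
    lift = path-mono there
    uv : Path ((u , v) ∷ S) u v
    uv = edge-path (here refl)
  ... | tri≈ _ refl _ = ⊥-elim (true≢false (Path⇒connected (cl ∘ there) (proj₂ (cl (here refl))) (reverse pu ++ₚ pv)) nc)
  ... | tri> _ _ gt = merge-roots v u rv ru there cl rv∈V ru∈V pv pu hv hu gt
                        (lift pv ++ₚ reverse uv ++ₚ reverse (lift pu)) (swap-via ∘ path-∷)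
    where
    lift : ∀ {a b} → Path S a b → Path ((u , v) ∷ S) a b
    lift = path-mono there
    uv : Path ((u , v) ∷ S) u v
    uv = edge-path (here refl)
    swap-via : ∀ {y x} → PathVia S u v y x → PathVia S v u y x
    swap-via (inj₁ a) = inj₁ a
    swap-via (inj₂ (inj₁ a)) = inj₂ (inj₂ a)
    swap-via (inj₂ (inj₂ a)) = inj₂ (inj₁ a)

  components-[] : components V [] ≡ length V
  components-[] = trans (cong length (filterᵇ-cong _ (λ _ → true) V λ {x} _ → all-intro _ V λ {y} _ → isolated-root x y))
                        (length-filterᵇ-true V)
    where
    isolated-root : ∀ x y → not ((y <ᵇ x) ∧ connected V [] y x) ≡ true
    isolated-root x y with y <ᵇ x in lt | connected V [] y x in c
    ... | false | _ = refl
    ... | true | false = refl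
    ... | true | true with path-to-isolated (λ ()) (connected⇒Path V [] y x c)
    ... | refl = ⊥-elim (<-irrefl refl (<ᵇ⇒<′ {x} {x} lt))
    length-filterᵇ-true : ∀ xs → length (filterᵇ (λ _ → true) xs) ≡ length xs
    length-filterᵇ-true [] = refl
    length-filterᵇ-true (x ∷ xs) = cong suc (length-filterᵇ-true xs)

-- Sums over edge subsets

toℕ : Bool → ℕ
toℕ true = 1
toℕ false = 0

length-filterᵇ : ∀ {A : Set} (P : A → Bool) xs → length (filterᵇ P xs) ≡ sum (map (toℕ ∘ P) xs)
length-filterᵇ P [] = refl
length-filterᵇ P (x ∷ xs) with P x
... | true = cong suc (length-filterᵇ P xs)
... | false = length-filterᵇ P xs

sum-map-cong : ∀ {A : Set} (f g : A → ℕ) xs → (∀ {x} → x ∈ xs → f x ≡ g x) → sum (map f xs) ≡ sum (map g xs)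
sum-map-cong f g [] h = refl
sum-map-cong f g (x ∷ xs) h = cong₂ _+_ (h (here refl)) (sum-map-cong f g xs (h ∘ there))

sum-map-+ : ∀ {A : Set} (f g : A → ℕ) xs → sum (map f xs) + sum (map g xs) ≡ sum (map (λ x → f x + g x) xs)
sum-map-+ f g [] = refl
sum-map-+ f g (x ∷ xs) =
  trans (+-interchange (f x) (sum (map f xs)) (g x) (sum (map g xs))) (cong (f x + g x +_) (sum-map-+ f g xs))

sublistSum : (List Edge → ℕ) → List Edge → ℕ
sublistSum h xs = sum (map h (sublists xs))

sublistSum-∷ : ∀ h x xs → sublistSum h (x ∷ xs) ≡ sublistSum h xs + sublistSum (h ∘ (x ∷_)) xs
sublistSum-∷ h x xs = begin
  sum (map h (sublists xs ++ map (x ∷_) (sublists xs)))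
    ≡⟨ cong sum (map-++ h (sublists xs) _) ⟩
  sum (map h (sublists xs) ++ map h (map (x ∷_) (sublists xs)))
    ≡⟨ sum-++ (map h (sublists xs)) _ ⟩
  sublistSum h xs + sum (map h (map (x ∷_) (sublists xs)))
    ≡⟨ cong (λ z → sublistSum h xs + sum z) (sym (map-∘ (sublists xs))) ⟩
  sublistSum h xs + sublistSum (h ∘ (x ∷_)) xs ∎

sublistSum-cong : ∀ (h h′ : List Edge → ℕ) xs → (∀ T → h T ≡ h′ T) → sublistSum h xs ≡ sublistSum h′ xs
sublistSum-cong h h′ xs e = sum-map-cong h h′ (sublists xs) (λ {T} _ → e T)

sublistSum-+ : ∀ (f g : List Edge → ℕ) L → sublistSum f L + sublistSum g L ≡ sublistSum (λ T → f T + g T) L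
sublistSum-+ f g L = sum-map-+ f g (sublists L)

PermInvariant : {B : Set} → (List Edge → B) → Set
PermInvariant h = ∀ {T T′} → T ↭ T′ → h T ≡ h T′

sublistSum-↭ : ∀ {xs ys} → xs ↭ ys → ∀ h → PermInvariant h → sublistSum h xs ≡ sublistSum h ys
sublistSum-↭ ↭.refl h inv = refl
sublistSum-↭ {x ∷ xs} {x ∷ ys} (prep x p) h inv = begin
  sublistSum h (x ∷ xs)                          ≡⟨ sublistSum-∷ h x xs ⟩
  sublistSum h xs + sublistSum (h ∘ (x ∷_)) xs    ≡⟨ cong₂ _+_ (sublistSum-↭ p h inv) (sublistSum-↭ p (h ∘ (x ∷_)) (inv ∘ prep x)) ⟩
  sublistSum h ys + sublistSum (h ∘ (x ∷_)) ys    ≡⟨ sym (sublistSum-∷ h x ys) ⟩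
  sublistSum h (x ∷ ys) ∎
sublistSum-↭ {x ∷ y ∷ xs} {y ∷ x ∷ ys} (swap x y p) h inv = begin
  sublistSum h (x ∷ y ∷ xs)
    ≡⟨ sublistSum-∷ h x (y ∷ xs) ⟩
  sublistSum h (y ∷ xs) + Σˢ hx (y ∷ xs)
    ≡⟨ cong₂ _+_ (sublistSum-∷ h y xs) (sublistSum-∷ hx y xs) ⟩
  (Σˢ h xs + Σˢ hy xs) + (Σˢ hx xs + Σˢ hxy xs)
    ≡⟨ +-interchange (Σˢ h xs) (Σˢ hy xs) (Σˢ hx xs) (Σˢ hxy xs) ⟩
  (Σˢ h xs + Σˢ hx xs) + (Σˢ hy xs + Σˢ hxy xs)
    ≡⟨ cong₂ _+_ (cong₂ _+_ (sublistSum-↭ p h inv) (sublistSum-↭ p hx (inv ∘ prep x)))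
                 (cong₂ _+_ (sublistSum-↭ p hy (inv ∘ prep y))
                            (trans (sublistSum-↭ p hxy (inv ∘ prep x ∘ prep y))
                                   (sublistSum-cong hxy hyx ys (λ T → inv (swap x y ↭.refl))))) ⟩
  (Σˢ h ys + Σˢ hx ys) + (Σˢ hy ys + Σˢ hyx ys)
    ≡⟨ sym (cong₂ _+_ (sublistSum-∷ h x ys) (sublistSum-∷ hy x ys)) ⟩
  sublistSum h (x ∷ ys) + Σˢ hy (x ∷ ys)
    ≡⟨ sym (sublistSum-∷ h y (x ∷ ys)) ⟩
  sublistSum h (y ∷ x ∷ ys) ∎
  where
  Σˢ : (List Edge → ℕ) → List Edge → ℕ
  Σˢ = sublistSum
  hx hy hxy hyx : List Edge → ℕ
  hx = h ∘ (x ∷_)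
  hy = h ∘ (y ∷_)
  hxy = h ∘ (x ∷_) ∘ (y ∷_)
  hyx = h ∘ (y ∷_) ∘ (x ∷_)
sublistSum-↭ (↭.trans p q) h inv = trans (sublistSum-↭ p h inv) (sublistSum-↭ q h inv)

any-↭ : ∀ {A : Set} (p : A → Bool) {xs ys} → xs ↭ ys → any p xs ≡ any p ys
any-↭ p ↭.refl = refl
any-↭ p (prep x q) = cong (p x ∨_) (any-↭ p q)
any-↭ p (swap x y q) = trans (∨-exchange (p x) (p y) _) (cong (λ z → p y ∨ (p x ∨ z)) (any-↭ p q))
any-↭ p (↭.trans q r) = trans (any-↭ p q) (any-↭ p r)

connected-↭ : ∀ V u v → PermInvariant (λ S → connected V S u v)
connected-↭ V u v {S} {S′} q = reachK-↭ (length V) u v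
  where
  adj-↭ : ∀ u v → adj S u v ≡ adj S′ u v
  adj-↭ u v = trans (adj-any S u v) (trans (any-↭ (joins u v) q) (sym (adj-any S′ u v)))
  reachK-↭ : ∀ k u v → reachK k V S u v ≡ reachK k V S′ u v
  reachK-↭ zero u v = refl
  reachK-↭ (suc k) u v = cong₂ _∨_ (reachK-↭ k u v)
    (any-cong _ _ V (λ {w} _ → cong₂ _∧_ (reachK-↭ k u w) (adj-↭ w v)))

components-↭ : ∀ V → PermInvariant (components V)
components-↭ V q = cong length (filterᵇ-cong _ _ V λ {x} _ →
  all-cong _ _ V λ {y} _ → cong (λ b → not ((y <ᵇ x) ∧ b)) (connected-↭ V y x q))

keep : Edge → Edge × List Edge → Edge × List Edge
keep x (y , ys) = y , x ∷ ys

-- picks, with the pattern lambda of Defs replaced by a named function that proofs can refer to.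
picks′ : List Edge → List (Edge × List Edge)
picks′ [] = []
picks′ (x ∷ xs) = (x , xs) ∷ map (keep x) (picks′ xs)

picks≡picks′ : ∀ xs → picks xs ≡ picks′ xs
picks≡picks′ [] = refl
picks≡picks′ (x ∷ xs) =
  cong ((x , xs) ∷_) (trans (map-cong (λ { (a , b) → refl }) (picks xs)) (cong (map (keep x)) (picks≡picks′ xs)))

RestInvariant : (Edge × List Edge → Bool) → Set
RestInvariant Q = ∀ e {R R′} → R ↭ R′ → Q (e , R) ≡ Q (e , R′)

all-picks′-↭ : ∀ {xs ys} → xs ↭ ys → ∀ Q → RestInvariant Q → all Q (picks′ xs) ≡ all Q (picks′ ys)
all-picks′-↭ ↭.refl Q inv = refl
all-picks′-↭ {x ∷ xs} {x ∷ ys} (prep x p) Q inv = cong₂ _∧_ (inv x p) (begin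
  all Q (map (keep x) (picks′ xs))  ≡⟨ all-map Q (keep x) (picks′ xs) ⟩
  all (Q ∘ keep x) (picks′ xs)      ≡⟨ all-picks′-↭ p (Q ∘ keep x) (λ e r → inv e (prep x r)) ⟩
  all (Q ∘ keep x) (picks′ ys)      ≡⟨ sym (all-map Q (keep x) (picks′ ys)) ⟩
  all Q (map (keep x) (picks′ ys))  ∎)
all-picks′-↭ {x ∷ y ∷ xs} {y ∷ x ∷ ys} (swap x y p) Q inv = begin
  Q (x , y ∷ xs) ∧ (Q (y , x ∷ xs) ∧ all Q (map (keep x) (map (keep y) (picks′ xs))))
    ≡⟨ cong (λ z → Q (x , y ∷ xs) ∧ (Q (y , x ∷ xs) ∧ z)) (all-map² x y xs) ⟩
  Q (x , y ∷ xs) ∧ (Q (y , x ∷ xs) ∧ all Qxy (picks′ xs))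
    ≡⟨ ∧-exchange (Q (x , y ∷ xs)) (Q (y , x ∷ xs)) _ ⟩
  Q (y , x ∷ xs) ∧ (Q (x , y ∷ xs) ∧ all Qxy (picks′ xs))
    ≡⟨ cong₂ _∧_ (inv y (prep x p)) (cong₂ _∧_ (inv x (prep y p))
         (all-picks′-↭ p Qxy (λ e r → inv e (prep x (prep y r))))) ⟩
  Q (y , x ∷ ys) ∧ (Q (x , y ∷ ys) ∧ all Qxy (picks′ ys))
    ≡⟨ cong (λ z → Q (y , x ∷ ys) ∧ (Q (x , y ∷ ys) ∧ z))
         (all-cong Qxy Qyx (picks′ ys) (λ { {e , R} _ → inv e (swap x y ↭.refl) })) ⟩
  Q (y , x ∷ ys) ∧ (Q (x , y ∷ ys) ∧ all Qyx (picks′ ys))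
    ≡⟨ sym (cong (λ z → Q (y , x ∷ ys) ∧ (Q (x , y ∷ ys) ∧ z)) (all-map² y x ys)) ⟩
  Q (y , x ∷ ys) ∧ (Q (x , y ∷ ys) ∧ all Q (map (keep y) (map (keep x) (picks′ ys))))
    ∎
  where
  Qxy Qyx : Edge × List Edge → Bool
  Qxy = Q ∘ keep x ∘ keep y
  Qyx = Q ∘ keep y ∘ keep x
  all-map² : ∀ a b zs → all Q (map (keep a) (map (keep b) (picks′ zs))) ≡ all (Q ∘ keep a ∘ keep b) (picks′ zs)
  all-map² a b zs = trans (all-map Q (keep a) (map (keep b) (picks′ zs))) (all-map (Q ∘ keep a) (keep b) (picks′ zs))
all-picks′-↭ (↭.trans p q) Q inv = trans (all-picks′-↭ p Q inv) (all-picks′-↭ q Q inv)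

acyclic-↭ : ∀ V → PermInvariant (acyclic V)
acyclic-↭ V {S} {S′} q = begin
  all (cutFree V) (picks S)    ≡⟨ cong (all (cutFree V)) (picks≡picks′ S) ⟩
  all (cutFree V) (picks′ S)   ≡⟨ all-picks′-↭ q (cutFree V) (λ { (u , v) r → cong not (connected-↭ V u v r) }) ⟩
  all (cutFree V) (picks′ S′)  ≡⟨ sym (cong (all (cutFree V)) (picks≡picks′ S′)) ⟩
  all (cutFree V) (picks S′)   ∎

-- The scan automaton

-- The five vertices a scan step looks at: the centre, the first scanned rim vertex v_i,
-- the last scanned rim vertex, v_j (the centre until v_j is scanned) and the vertex being added.
data Slot : Set where
  centre start last target fresh : Slot

SlotRel : Set
SlotRel = Slot → Slot → Bool

data Profile : Set where
  profile : (cs cl ct sl st lt : Bool) → Profile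

-- The fresh vertex is isolated before its edges are added.
relation : Profile → SlotRel
relation _ fresh fresh = true
relation _ fresh _ = false
relation _ _ fresh = false
relation _ centre centre = true
relation (profile cs cl ct sl st lt) centre start = cs
relation (profile cs cl ct sl st lt) centre last = cl
relation (profile cs cl ct sl st lt) centre target = ct
relation (profile cs cl ct sl st lt) start centre = cs
relation _ start start = true
relation (profile cs cl ct sl st lt) start last = sl
relation (profile cs cl ct sl st lt) start target = st
relation (profile cs cl ct sl st lt) last centre = cl
relation (profile cs cl ct sl st lt) last start = sl
relation _ last last = true
relation (profile cs cl ct sl st lt) last target = lt
relation (profile cs cl ct sl st lt) target centre = ct
relation (profile cs cl ct sl st lt) target start = st
relation (profile cs cl ct sl st lt) target last = lt
relation _ target target = true

all-connected : Profile
all-connected = profile true true true true true true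

-- After the first step without its spoke: v_i alone, the centre standing in for v_j.
start-alone : Profile
start-alone = profile false false true true false false

-- Where each slot of the next step sits in the five-slot picture of the current one.
Move : Set
Move = Slot → Slot

restrict : Move → SlotRel → Profile
restrict σ P = profile (P (σ centre) (σ start)) (P (σ centre) (σ last)) (P (σ centre) (σ target))
                       (P (σ start) (σ last)) (P (σ start) (σ target)) (P (σ last) (σ target))

-- The number of elements not related to an earlier one: the number of classes of an equivalence.
classCount : SlotRel → List Slot → List Slot → ℕ
classCount Q seen [] = 0
classCount Q seen (x ∷ xs) = (if any (λ y → Q y x) seen then 0 else 1) + classCount Q (x ∷ seen) xs

tracked : List Slot
tracked = centre ∷ start ∷ last ∷ target ∷ []

centre∈ : centre ∈ tracked
centre∈ = here refl

start∈ : start ∈ tracked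
start∈ = there (here refl)

last∈ : last ∈ tracked
last∈ = there (there (here refl))

target∈ : target ∈ tracked
target∈ = there (there (there (here refl)))

fresh∉tracked : fresh ∈ tracked → ⊥
fresh∉tracked (there (there (there (there ()))))

classes : Profile → ℕ
classes p = classCount (relation p) [] tracked

classes⁺ : SlotRel → ℕ
classes⁺ P = classCount P [] (fresh ∷ tracked)

transitive : Profile → Bool
transitive p = all (λ x → all (λ y → all (λ z → not (Q x y ∧ Q y z) ∨ Q x z) tracked) tracked) tracked
  where
  Q : SlotRel
  Q = relation p

firstMove : Move
firstMove centre = centre
firstMove start = fresh
firstMove last = fresh
firstMove target = centre
firstMove fresh = fresh

plainMove : Move
plainMove centre = centre
plainMove start = start
plainMove last = fresh
plainMove target = target
plainMove fresh = fresh

targetMove : Move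
targetMove centre = centre
targetMove start = start
targetMove last = fresh
targetMove target = fresh
targetMove fresh = fresh

afterRim : Profile → Bool → SlotRel
afterRim p r = if r then link last fresh (relation p) else relation p

afterStep : Profile → Bool → Bool → SlotRel
afterStep p s r = if s then link centre fresh (afterRim p r) else afterRim p r

closesCycle : Profile → Bool → Bool → Bool
closesCycle p s r = (r ∧ relation p last fresh) ∨ (s ∧ afterRim p r centre fresh)

merges : Profile → Bool → Bool → ℕ
merges p s r = toℕ (r ∧ not (relation p last fresh)) + toℕ (s ∧ not (afterRim p r centre fresh))

-- Classes that lose all their tracked vertices: they can never be joined again.
dropped : Move → Profile → Bool → Bool → ℕ
dropped σ p s r = classes⁺ (afterStep p s r) ∸ classes (restrict σ (afterStep p s r))

data State : Set where
  dead : State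
  live : Profile → State

step : Move → Bool → Bool → State → State
step σ s r dead = dead
step σ s r (live p) =
  if closesCycle p s r ∨ not (dropped σ p s r ≡ᵇ 0) then dead else live (restrict σ (afterStep p s r))

afterClose : Profile → Bool → SlotRel
afterClose p c = if c then link last start (relation p) else relation p

closed : Profile → Bool → Profile
closed p c = restrict id (afterClose p c)

closesCycleᶜ : Profile → Bool → Bool
closesCycleᶜ p c = c ∧ relation p last start

mergesᶜ : Profile → Bool → ℕ
mergesᶜ p c = toℕ (c ∧ not (relation p last start))

allBool : (Bool → Bool) → Bool
allBool f = f true ∧ f false

allBool-sound : ∀ f → allBool f ≡ true → ∀ b → f b ≡ true
allBool-sound f h true with f true | f false | h
... | true | true | _ = refl
allBool-sound f h false with f true | f false | h
... | true | true | _ = refl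

allProfiles : (Profile → Bool) → Bool
allProfiles f = allBool λ a → allBool λ b → allBool λ c → allBool λ d → allBool λ e → allBool λ g →
  f (profile a b c d e g)

allProfiles-sound : ∀ f → allProfiles f ≡ true → ∀ p → f p ≡ true
allProfiles-sound f h (profile a b c d e g) =
  allBool-sound (λ g → f (profile a b c d e g))
   (allBool-sound (λ e → allBool λ g → f (profile a b c d e g))
    (allBool-sound (λ d → allBool λ e → allBool λ g → f (profile a b c d e g))
     (allBool-sound (λ c → allBool λ d → allBool λ e → allBool λ g → f (profile a b c d e g))
      (allBool-sound (λ b → allBool λ c → allBool λ d → allBool λ e → allBool λ g → f (profile a b c d e g))
       (allBool-sound (λ a → allBool λ b → allBool λ c → allBool λ d → allBool λ e → allBool λ g →
                              f (profile a b c d e g)) h a) b) c) d) e) g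

onTransitive : (Profile → Bool) → Profile → Bool
onTransitive f p = not (transitive p) ∨ f p

checked : ∀ f → allProfiles (onTransitive f) ≡ true → ∀ p → transitive p ≡ true → f p ≡ true
checked f h p t with allProfiles-sound (onTransitive f) h p
... | fp rewrite t = fp

stepFacts : Move → Profile → Bool → Bool → Bool
stepFacts σ p s r =
  ((classes⁺ (afterStep p s r) + merges p s r) ≡ᵇ (classes p + 1))
  ∧ (classes (restrict σ (afterStep p s r)) ≤ᵇ classes⁺ (afterStep p s r))

stepCount : Move → Profile → Bool
stepCount σ p = allBool λ s → allBool λ r → stepFacts σ p s r

closeFacts : Profile → Bool → Bool
closeFacts p c =
  ((classes (closed p c) + mergesᶜ p c) ≡ᵇ classes p)
  ∧ ((afterClose p c start target ∨ (2 ≤ᵇ classes (closed p c))) ∧ (1 ≤ᵇ classes (closed p c)))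

closeCount : Profile → Bool
closeCount p = allBool (closeFacts p)

firstMove-counts : allProfiles (onTransitive (stepCount firstMove)) ≡ true
firstMove-counts = refl

plainMove-counts : allProfiles (onTransitive (stepCount plainMove)) ≡ true
plainMove-counts = refl

targetMove-counts : allProfiles (onTransitive (stepCount targetMove)) ≡ true
targetMove-counts = refl

close-counts : allProfiles (onTransitive closeCount) ≡ true
close-counts = refl

-- A partial edge set is live when it is acyclic and its only components are the classes
-- of the tracked vertices and the isolated unscanned vertices.
stateOf : Bool → ℕ → ℕ → Profile → State
stateOf acyc comps unscanned p = if acyc ∧ (comps ≡ᵇ unscanned + classes p) then live p else dead

≡ᵇ-+ : ∀ m k → ((m + k) ≡ᵇ m) ≡ (k ≡ᵇ 0)
≡ᵇ-+ zero zero = refl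
≡ᵇ-+ zero (suc k) = refl
≡ᵇ-+ (suc m) k = ≡ᵇ-+ m k

stepCount-sound : ∀ σ p → stepCount σ p ≡ true → ∀ s r →
  classes⁺ (afterStep p s r) + merges p s r ≡ classes p + 1 × classes (restrict σ (afterStep p s r)) ≤ classes⁺ (afterStep p s r)
stepCount-sound σ p h s r = ≡ᵇ⇒≡′ (∧-conicalˡ _ _ facts) , ≤ᵇ⇒≤′ (∧-conicalʳ _ _ facts)
  where
  facts : stepFacts σ p s r ≡ true
  facts = allBool-sound (stepFacts σ p s) (allBool-sound (λ s → allBool (stepFacts σ p s)) h s) r

-- The state is live exactly when no cycle was closed, no class was dropped and no
-- component had been lost before.
step-stateOf-if : ∀ σ p s r (a : Bool) x →
  (if (not (closesCycle p s r) ∧ a) ∧ ((dropped σ p s r + x) ≡ᵇ 0) then live (restrict σ (afterStep p s r)) else dead)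
  ≡ step σ s r (if a ∧ (x ≡ᵇ 0) then live p else dead)
step-stateOf-if σ p s r false x rewrite ∧-zeroʳ (not (closesCycle p s r)) = refl
step-stateOf-if σ p s r true (suc x) rewrite +-suc (dropped σ p s r) x | ∧-zeroʳ (not (closesCycle p s r) ∧ true) = refl
step-stateOf-if σ p s r true zero rewrite +-identityʳ (dropped σ p s r) with closesCycle p s r | dropped σ p s r
... | true | zero = refl
... | false | zero = refl
... | true | suc _ = refl
... | false | suc _ = refl

module _ (σ : Move) (p : Profile) (s r : Bool) where

  private
    p′ : Profile
    p′ = restrict σ (afterStep p s r)

  -- Writing comps = (unscanned + classes p) + excess, the new excess is the old one plus
  -- the dropped classes.
  step-stateOf : ∀ a a′ comps comps′ off → stepCount σ p ≡ true →
    suc off + classes p ≤ comps → comps′ + merges p s r ≡ comps → a′ ≡ not (closesCycle p s r) ∧ a →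
    off + classes p′ ≤ comps′ × stateOf a′ comps′ off p′ ≡ step σ s r (stateOf a comps (suc off) p)
  step-stateOf a a′ comps comps′ off counts le split acyc′ = bound , states
    where
    R⁺ R : ℕ
    R⁺ = classes⁺ (afterStep p s r)
    R = classes p′
    count : R⁺ + merges p s r ≡ classes p + 1 × R ≤ R⁺
    count = stepCount-sound σ p counts s r
    x : ℕ
    x = comps ∸ (suc off + classes p)
    comps≡ : comps ≡ (suc off + classes p) + x
    comps≡ = sym (m+[n∸m]≡n le)
    R⁺≡ : R⁺ ≡ R + dropped σ p s r
    R⁺≡ = sym (m+[n∸m]≡n (proj₂ count))
    comps′≡ : comps′ ≡ (off + R) + (dropped σ p s r + x)
    comps′≡ = +-cancelʳ-≡ (merges p s r) _ _ (trans split (trans comps≡ (sym rearranged)))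
      where
      d : ℕ
      d = dropped σ p s r
      rearranged : (off + R) + (d + x) + merges p s r ≡ (suc off + classes p) + x
      rearranged = begin
        (off + R) + (d + x) + merges p s r
          ≡⟨ solve 5 (λ o r₄ dd xx m → (o :+ r₄) :+ (dd :+ xx) :+ m := o :+ ((r₄ :+ dd) :+ m) :+ xx) refl off R d x (merges p s r) ⟩
        off + ((R + d) + merges p s r) + x
          ≡⟨ cong (λ z → off + (z + merges p s r) + x) (sym R⁺≡) ⟩
        off + (R⁺ + merges p s r) + x
          ≡⟨ cong (λ z → off + z + x) (proj₁ count) ⟩
        off + (classes p + 1) + x
          ≡⟨ solve 3 (λ o c xx → o :+ (c :+ con 1) :+ xx := (con 1 :+ o :+ c) :+ xx) refl off (classes p) x ⟩
        (suc off + classes p) + x ∎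
    bound : off + R ≤ comps′
    bound = subst (off + R ≤_) (sym comps′≡) (m≤m+n (off + R) _)
    states : stateOf a′ comps′ off p′ ≡ step σ s r (stateOf a comps (suc off) p)
    states = trans (cong₂ (λ b z → if b ∧ z then live p′ else dead) acyc′ (trans (cong (_≡ᵇ off + R) comps′≡) (≡ᵇ-+ (off + R) _)))
             (trans (step-stateOf-if σ p s r a x)
                    (cong (λ z → step σ s r (if a ∧ z then live p else dead))
                          (sym (trans (cong (_≡ᵇ suc off + classes p) comps≡) (≡ᵇ-+ (suc off + classes p) x)))))

acceptForest : Bool → State → Bool
acceptForest c dead = false
acceptForest c (live p) = not (closesCycleᶜ p c) ∧ ((classes (closed p c) ≡ᵇ 2) ∧ not (afterClose p c start target))

acceptTree : Bool → State → Bool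
acceptTree c dead = false
acceptTree c (live p) = not (closesCycleᶜ p c) ∧ (classes (closed p c) ≡ᵇ 1)

if-live : ∀ (f : State → Bool) b p → f (if b then live p else dead) ≡ (if b then f (live p) else f dead)
if-live f true p = refl
if-live f false p = refl

-- The hypothesis fj ∨ 2 ≤ R rules out R + x ≡ 2 with an excess x > 0.
accept-forest-if : ∀ (a cy fj : Bool) (R x : ℕ) → (fj ∨ (2 ≤ᵇ R)) ≡ true →
  ((not cy ∧ a) ∧ (((R + x) ≡ᵇ 2) ∧ not fj)) ≡ (if a ∧ (x ≡ᵇ 0) then (not cy ∧ ((R ≡ᵇ 2) ∧ not fj)) else false)
accept-forest-if false cy fj R x h rewrite ∧-zeroʳ (not cy) = refl
accept-forest-if true cy true R x h with cy | (R + x) ≡ᵇ 2 | R ≡ᵇ 2 | x ≡ᵇ 0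
... | a₁ | a₂ | a₃ | true rewrite ∧-zeroʳ a₂ | ∧-zeroʳ a₃ | ∧-zeroʳ (not a₁) | ∧-zeroʳ (not a₁ ∧ true) = refl
... | a₁ | a₂ | a₃ | false rewrite ∧-zeroʳ a₂ | ∧-zeroʳ (not a₁ ∧ true) = refl
accept-forest-if true cy false (suc (suc R)) (suc x) h rewrite +-suc R x | ∧-zeroʳ (not cy ∧ true) = refl
accept-forest-if true cy false R zero h rewrite +-identityʳ R with cy
... | true = refl
... | false = refl

accept-tree-if : ∀ (a cy : Bool) (R x : ℕ) → (1 ≤ᵇ R) ≡ true →
  ((not cy ∧ a) ∧ ((R + x) ≡ᵇ 1)) ≡ (if a ∧ (x ≡ᵇ 0) then (not cy ∧ (R ≡ᵇ 1)) else false)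
accept-tree-if false cy R x h rewrite ∧-zeroʳ (not cy) = refl
accept-tree-if true cy (suc R) (suc x) h rewrite +-suc R x | ∧-zeroʳ (not cy ∧ true) = refl
accept-tree-if true cy R zero h rewrite +-identityʳ R with cy
... | true = refl
... | false = refl

module _ (p : Profile) (c : Bool) where

  private
    R : ℕ
    R = classes (closed p c)
    facts : closeCount p ≡ true → closeFacts p c ≡ true
    facts counts = allBool-sound (closeFacts p) counts c

  close-components : ∀ comps comps′ → closeCount p ≡ true → classes p ≤ comps → comps′ + mergesᶜ p c ≡ comps →
    comps′ ≡ classes (closed p c) + (comps ∸ classes p)
  close-components comps comps′ counts le split = +-cancelʳ-≡ (mergesᶜ p c) _ _ (begin
    comps′ + mergesᶜ p c                     ≡⟨ split ⟩
    comps                                    ≡⟨ sym (m+[n∸m]≡n le) ⟩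
    classes p + (comps ∸ classes p)          ≡⟨ cong (_+ (comps ∸ classes p)) (sym count) ⟩
    R + mergesᶜ p c + (comps ∸ classes p)    ≡⟨ solve 3 (λ a b c → (a :+ b) :+ c := (a :+ c) :+ b) refl R (mergesᶜ p c) _ ⟩
    R + (comps ∸ classes p) + mergesᶜ p c    ∎)
    where
    count : R + mergesᶜ p c ≡ classes p
    count = ≡ᵇ⇒≡′ (∧-conicalˡ ((R + mergesᶜ p c) ≡ᵇ classes p) _ (facts counts))

  close-stateOf : ∀ a a′ comps comps′ fj → closeCount p ≡ true → classes p ≤ comps →
    comps′ + mergesᶜ p c ≡ comps → a′ ≡ not (closesCycleᶜ p c) ∧ a → fj ≡ afterClose p c start target →
    (a′ ∧ ((comps′ ≡ᵇ 2) ∧ not fj)) ≡ acceptForest c (stateOf a comps 0 p)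
    × (a′ ∧ (comps′ ≡ᵇ 1)) ≡ acceptTree c (stateOf a comps 0 p)
  close-stateOf a a′ comps comps′ fj counts le split acyc′ fj≡ = forest , tree
    where
    bounds : ((afterClose p c start target ∨ (2 ≤ᵇ R)) ∧ (1 ≤ᵇ R)) ≡ true
    bounds = ∧-conicalʳ ((R + mergesᶜ p c) ≡ᵇ classes p) _ (facts counts)
    x : ℕ
    x = comps ∸ classes p
    comps′≡ : comps′ ≡ R + x
    comps′≡ = close-components comps comps′ counts le split
    no-excess : (comps ≡ᵇ 0 + classes p) ≡ (x ≡ᵇ 0)
    no-excess = trans (cong (_≡ᵇ classes p) (sym (m+[n∸m]≡n le))) (≡ᵇ-+ (classes p) x)
    forest : (a′ ∧ ((comps′ ≡ᵇ 2) ∧ not fj)) ≡ acceptForest c (stateOf a comps 0 p)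
    forest = begin
      a′ ∧ ((comps′ ≡ᵇ 2) ∧ not fj)
        ≡⟨ cong₂ (λ b z → b ∧ ((z ≡ᵇ 2) ∧ not fj)) acyc′ comps′≡ ⟩
      (not (closesCycleᶜ p c) ∧ a) ∧ (((R + x) ≡ᵇ 2) ∧ not fj)
        ≡⟨ cong (λ z → (not (closesCycleᶜ p c) ∧ a) ∧ (((R + x) ≡ᵇ 2) ∧ not z)) fj≡ ⟩
      (not (closesCycleᶜ p c) ∧ a) ∧ (((R + x) ≡ᵇ 2) ∧ not (afterClose p c start target))
        ≡⟨ accept-forest-if a (closesCycleᶜ p c) _ R x (∧-conicalˡ _ (1 ≤ᵇ R) bounds) ⟩
      (if a ∧ (x ≡ᵇ 0) then acceptForest c (live p) else false)
        ≡⟨ cong (λ z → if a ∧ z then acceptForest c (live p) else false) (sym no-excess) ⟩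
      (if a ∧ (comps ≡ᵇ 0 + classes p) then acceptForest c (live p) else false)
        ≡⟨ sym (if-live (acceptForest c) (a ∧ (comps ≡ᵇ 0 + classes p)) p) ⟩
      acceptForest c (stateOf a comps 0 p) ∎
    tree : (a′ ∧ (comps′ ≡ᵇ 1)) ≡ acceptTree c (stateOf a comps 0 p)
    tree = begin
      a′ ∧ (comps′ ≡ᵇ 1)
        ≡⟨ cong₂ (λ b z → b ∧ (z ≡ᵇ 1)) acyc′ comps′≡ ⟩
      (not (closesCycleᶜ p c) ∧ a) ∧ ((R + x) ≡ᵇ 1)
        ≡⟨ accept-tree-if a (closesCycleᶜ p c) R x (∧-conicalʳ (afterClose p c start target ∨ (2 ≤ᵇ R)) _ bounds) ⟩
      (if a ∧ (x ≡ᵇ 0) then acceptTree c (live p) else false)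
        ≡⟨ cong (λ z → if a ∧ z then acceptTree c (live p) else false) (sym no-excess) ⟩
      (if a ∧ (comps ≡ᵇ 0 + classes p) then acceptTree c (live p) else false)
        ≡⟨ sym (if-live (acceptTree c) (a ∧ (comps ≡ᵇ 0 + classes p)) p) ⟩
      acceptTree c (stateOf a comps 0 p) ∎

-- Solving the transfer recurrences

sumSteps : {X : Set} → (X → X → X) → Move → (State → X) → State → X
sumSteps _⊕_ σ f st = (f (step σ false false st) ⊕ f (step σ false true st)) ⊕ (f (step σ true false st) ⊕ f (step σ true true st))

transfer : Move → (State → ℕ) → State → ℕ
transfer = sumSteps _+_

transfer₀ : (State → ℕ) → State → ℕ
transfer₀ w st = w (step firstMove false false st) + w (step firstMove true false st)

transferⁿ : ℕ → (State → ℕ) → State → ℕ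
transferⁿ zero w = w
transferⁿ (suc k) w = transfer plainMove (transferⁿ k w)

forestWeight : State → ℕ
forestWeight st = toℕ (acceptForest false st) + toℕ (acceptForest true st)

treeWeight : State → ℕ
treeWeight st = toℕ (acceptTree false st) + toℕ (acceptTree true st)

transferⁿ-dead : ∀ k w → w dead ≡ 0 → transferⁿ k w dead ≡ 0
transferⁿ-dead zero w h = h
transferⁿ-dead (suc k) w h rewrite transferⁿ-dead k w h = refl

transitiveState : State → Bool
transitiveState dead = true
transitiveState (live p) = transitive p

preserves : Move → Profile → Bool
preserves σ p = allBool λ s → allBool λ r → transitiveState (step σ s r (live p))

preserves-sound : ∀ σ p → preserves σ p ≡ true → ∀ s r → transitiveState (step σ s r (live p)) ≡ true
preserves-sound σ p h s r =
  allBool-sound (λ r → transitiveState (step σ s r (live p)))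
    (allBool-sound (λ s → allBool λ r → transitiveState (step σ s r (live p))) h s) r

plainMove-preserves : allProfiles (onTransitive (preserves plainMove)) ≡ true
plainMove-preserves = refl

targetMove-preserves : allProfiles (onTransitive (preserves targetMove)) ≡ true
targetMove-preserves = refl

sumSteps-hom : {X : Set} (h : X → ℕ) (_⊕_ : X → X → X) → (∀ x y → h (x ⊕ y) ≡ h x + h y) →
  ∀ σ f st → h (sumSteps _⊕_ σ f st) ≡ sumSteps _+_ σ (h ∘′ f) st
sumSteps-hom h _⊕_ hom σ f st = trans (hom _ _) (cong₂ _+_ (hom _ _) (hom _ _))

onLive : {X : Set} → X → (Profile → X) → State → X
onLive 𝟘 f dead = 𝟘
onLive 𝟘 f (live p) = f p

-- A solution of the transfer recurrence by a table of coefficient vectors: ⟦ L ⟧ reads off a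
-- count after L steps, and one more step acts on coefficient vectors by advance.
module Solution {X : Set} (⟦_⟧ : ℕ → X → ℕ) (_⊕_ : X → X → X) (𝟘 : X) (advance : X → X)
  (⟦⊕⟧ : ∀ L x y → ⟦ L ⟧ (x ⊕ y) ≡ ⟦ L ⟧ x + ⟦ L ⟧ y) (⟦𝟘⟧ : ∀ L → ⟦ L ⟧ 𝟘 ≡ 0)
  (⟦advance⟧ : ∀ L x → ⟦ suc L ⟧ x ≡ ⟦ L ⟧ (advance x))
  (w₀ : State → ℕ) (w₀-dead : w₀ dead ≡ 0) (coef : Profile → X)
  (initial : ∀ p → transitive p ≡ true → w₀ (live p) ≡ ⟦ 0 ⟧ (coef p))
  (recurrence : ∀ p → transitive p ≡ true →
    sumSteps _⊕_ plainMove (onLive 𝟘 coef) (live p) ≡ advance (coef p))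
  where

  coefOf : State → X
  coefOf = onLive 𝟘 coef

  solution : ∀ L st → transitiveState st ≡ true → transferⁿ L w₀ st ≡ ⟦ L ⟧ (coefOf st)
  solution L dead _ = trans (transferⁿ-dead L w₀ w₀-dead) (sym (⟦𝟘⟧ L))
  solution zero (live p) t = initial p t
  solution (suc L) (live p) t = begin
    transfer plainMove (transferⁿ L w₀) (live p)
      ≡⟨ cong₂ _+_ (cong₂ _+_ (next false false) (next false true)) (cong₂ _+_ (next true false) (next true true)) ⟩
    sumSteps _+_ plainMove (⟦ L ⟧ ∘′ coefOf) (live p)
      ≡⟨ sym (sumSteps-hom ⟦ L ⟧ _⊕_ (⟦⊕⟧ L) plainMove coefOf (live p)) ⟩
    ⟦ L ⟧ (sumSteps _⊕_ plainMove coefOf (live p))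
      ≡⟨ cong ⟦ L ⟧ (recurrence p t) ⟩
    ⟦ L ⟧ (advance (coef p))
      ≡⟨ sym (⟦advance⟧ L (coef p)) ⟩
    ⟦ suc L ⟧ (coef p) ∎
    where
    next : ∀ s r → transferⁿ L w₀ (step plainMove s r (live p)) ≡ ⟦ L ⟧ (coefOf (step plainMove s r (live p)))
    next s r = solution L _ (preserves-sound plainMove p (checked (preserves plainMove) plainMove-preserves p t) s r)

-- φ L = f_{2L} and ψ L = f_{2L+1} − 1 (see fib-φψ).
φ ψ : ℕ → ℕ
φ zero = 0
φ (suc L) = φ L + ψ L + 1
ψ zero = 0
ψ (suc L) = φ L + 2 * ψ L + 1

data Lin : Set where
  lin : ℕ → ℕ → ℕ → Lin

⟦_⟧ : ℕ → Lin → ℕ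
⟦ L ⟧ (lin x y z) = x + y * φ L + z * ψ L

_⊕_ : Lin → Lin → Lin
lin x y z ⊕ lin x′ y′ z′ = lin (x + x′) (y + y′) (z + z′)

𝟘 : Lin
𝟘 = lin 0 0 0

advance : Lin → Lin
advance (lin x y z) = lin (x + y + z) (y + z) (y + 2 * z)

_≟ₗ_ : Lin → Lin → Bool
lin x y z ≟ₗ lin x′ y′ z′ = (x ≡ᵇ x′) ∧ ((y ≡ᵇ y′) ∧ (z ≡ᵇ z′))

≟ₗ-sound : ∀ u v → (u ≟ₗ v) ≡ true → u ≡ v
≟ₗ-sound (lin x y z) (lin x′ y′ z′) h = cong₂ (λ f w → f w) (cong₂ lin x≡x′ y≡y′) z≡z′
  where
  rest : (y ≡ᵇ y′) ∧ (z ≡ᵇ z′) ≡ true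
  rest = ∧-conicalʳ (x ≡ᵇ x′) _ h
  x≡x′ : x ≡ x′
  x≡x′ = ≡ᵇ⇒≡′ (∧-conicalˡ (x ≡ᵇ x′) _ h)
  y≡y′ : y ≡ y′
  y≡y′ = ≡ᵇ⇒≡′ (∧-conicalˡ (y ≡ᵇ y′) _ rest)
  z≡z′ : z ≡ z′
  z≡z′ = ≡ᵇ⇒≡′ (∧-conicalʳ (y ≡ᵇ y′) _ rest)

⟦⊕⟧ : ∀ L u v → ⟦ L ⟧ (u ⊕ v) ≡ ⟦ L ⟧ u + ⟦ L ⟧ v
⟦⊕⟧ L (lin x y z) (lin x′ y′ z′) =
  solve 8 (λ x y z x′ y′ z′ A E → (x :+ x′) :+ (y :+ y′) :* A :+ (z :+ z′) :* E
                                  := (x :+ y :* A :+ z :* E) :+ (x′ :+ y′ :* A :+ z′ :* E))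
    refl x y z x′ y′ z′ (φ L) (ψ L)

⟦𝟘⟧ : ∀ L → ⟦ L ⟧ 𝟘 ≡ 0
⟦𝟘⟧ L = refl

⟦advance⟧ : ∀ L u → ⟦ suc L ⟧ u ≡ ⟦ L ⟧ (advance u)
⟦advance⟧ L (lin x y z) =
  solve 5 (λ x y z A E → x :+ y :* (A :+ E :+ con 1) :+ z :* (A :+ con 2 :* E :+ con 1)
                         := (x :+ y :+ z) :+ (y :+ z) :* A :+ (y :+ con 2 :* z) :* E)
    refl x y z (φ L) (ψ L)

⟦_⟧₀ : Lin → ℕ
⟦ lin x y z ⟧₀ = x

⟦⟧-zero : ∀ u → ⟦ 0 ⟧ u ≡ ⟦ u ⟧₀
⟦⟧-zero (lin x y z) = trans (cong₂ (λ u v → x + u + v) (*-zeroʳ y) (*-zeroʳ z)) (trans (+-identityʳ (x + 0)) (+-identityʳ x))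

-- The solutions of the recurrence on the 15 transitive profiles; the catch-all clause only
-- covers profiles that are not transitive.
forestCoef : Profile → Lin
forestCoef (profile true true true true true true) = lin 0 0 0
forestCoef (profile true true false true false false) = lin 1 1 1
forestCoef (profile true false true false true false) = lin 0 0 0
forestCoef (profile true false false false false true) = lin 1 1 1
forestCoef (profile true false false false false false) = lin 1 0 1
forestCoef (profile false true true false false true) = lin 1 1 1
forestCoef (profile false true false false true false) = lin 0 0 0
forestCoef (profile false true false false false false) = lin 1 0 1
forestCoef (profile false false true true false false) = lin 1 1 1
forestCoef (profile false false true false false false) = lin 1 0 1
forestCoef (profile false false false true true true) = lin 0 0 0
forestCoef (profile false false false true false false) = lin 0 0 2
forestCoef (profile false false false false true false) = lin 0 0 0
forestCoef (profile false false false false false true) = lin 0 0 2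
forestCoef (profile false false false false false false) = lin 0 1 0
forestCoef _ = 𝟘

treeCoef : Profile → Lin
treeCoef (profile true true true true true true) = lin 1 1 1
treeCoef (profile true true false true false false) = lin 0 0 0
treeCoef (profile true false true false true false) = lin 1 0 1
treeCoef (profile true false false false false true) = lin 1 0 1
treeCoef (profile true false false false false false) = lin 0 0 0
treeCoef (profile false true true false false true) = lin 1 0 1
treeCoef (profile false true false false true false) = lin 1 0 1
treeCoef (profile false true false false false false) = lin 0 0 0
treeCoef (profile false false true true false false) = lin 0 0 2
treeCoef (profile false false true false false false) = lin 0 1 0
treeCoef (profile false false false true true true) = lin 0 0 2
treeCoef (profile false false false true false false) = lin 0 0 0
treeCoef (profile false false false false true false) = lin 0 1 0
treeCoef (profile false false false false false true) = lin 0 1 0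
treeCoef (profile false false false false false false) = lin 0 0 0
treeCoef _ = 𝟘

satisfiesRecurrence : (Profile → Lin) → Profile → Bool
satisfiesRecurrence coef p = sumSteps _⊕_ plainMove (onLive 𝟘 coef) (live p) ≟ₗ advance (coef p)

forestCoef-recurrence : allProfiles (onTransitive (satisfiesRecurrence forestCoef)) ≡ true
forestCoef-recurrence = refl

forestCoef-initial : allProfiles (onTransitive (λ p → forestWeight (live p) ≡ᵇ ⟦ forestCoef p ⟧₀)) ≡ true
forestCoef-initial = refl

treeCoef-recurrence : allProfiles (onTransitive (satisfiesRecurrence treeCoef)) ≡ true
treeCoef-recurrence = refl

treeCoef-initial : allProfiles (onTransitive (λ p → treeWeight (live p) ≡ᵇ ⟦ treeCoef p ⟧₀)) ≡ true
treeCoef-initial = refl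

solution-from-checks : ∀ (w₀ : State → ℕ) coef → w₀ dead ≡ 0 →
  allProfiles (onTransitive (λ p → w₀ (live p) ≡ᵇ ⟦ coef p ⟧₀)) ≡ true →
  allProfiles (onTransitive (satisfiesRecurrence coef)) ≡ true →
  ∀ L st → transitiveState st ≡ true → transferⁿ L w₀ st ≡ ⟦ L ⟧ (onLive 𝟘 coef st)
solution-from-checks w₀ coef w₀-dead init rec = Solution.solution ⟦_⟧ _⊕_ 𝟘 advance ⟦⊕⟧ ⟦𝟘⟧ ⟦advance⟧ w₀ w₀-dead coef
  (λ p t → trans (≡ᵇ⇒≡′ (checked (λ p → w₀ (live p) ≡ᵇ ⟦ coef p ⟧₀) init p t)) (sym (⟦⟧-zero (coef p))))
  (λ p t → ≟ₗ-sound _ _ (checked (satisfiesRecurrence coef) rec p t))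

forest-after-target : ∀ L st → transitiveState st ≡ true → transferⁿ L forestWeight st ≡ ⟦ L ⟧ (onLive 𝟘 forestCoef st)
forest-after-target = solution-from-checks forestWeight forestCoef refl forestCoef-initial forestCoef-recurrence

tree-solution : ∀ L st → transitiveState st ≡ true → transferⁿ L treeWeight st ≡ ⟦ L ⟧ (onLive 𝟘 treeCoef st)
tree-solution = solution-from-checks treeWeight treeCoef refl treeCoef-initial treeCoef-recurrence

data Lin² : Set where
  lin² : Lin → Lin → Lin → Lin²

⟦_∣_⟧² : ℕ → ℕ → Lin² → ℕ
⟦ t ∣ L ⟧² (lin² r₀ r₁ r₂) = ⟦ L ⟧ r₀ + φ t * ⟦ L ⟧ r₁ + ψ t * ⟦ L ⟧ r₂

_⊕²_ : Lin² → Lin² → Lin²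
lin² r₀ r₁ r₂ ⊕² lin² s₀ s₁ s₂ = lin² (r₀ ⊕ s₀) (r₁ ⊕ s₁) (r₂ ⊕ s₂)

𝟘² : Lin²
𝟘² = lin² 𝟘 𝟘 𝟘

advance² : Lin² → Lin²
advance² (lin² r₀ r₁ r₂) = lin² ((r₀ ⊕ r₁) ⊕ r₂) (r₁ ⊕ r₂) (r₁ ⊕ (r₂ ⊕ r₂))

row₀ : Lin² → Lin
row₀ (lin² r₀ _ _) = r₀

_≟²_ : Lin² → Lin² → Bool
lin² r₀ r₁ r₂ ≟² lin² s₀ s₁ s₂ = (r₀ ≟ₗ s₀) ∧ ((r₁ ≟ₗ s₁) ∧ (r₂ ≟ₗ s₂))

≟²-sound : ∀ u v → (u ≟² v) ≡ true → u ≡ v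
≟²-sound (lin² r₀ r₁ r₂) (lin² s₀ s₁ s₂) h = cong₂ (λ f w → f w) (cong₂ lin² (≟ₗ-sound r₀ s₀ e₀) (≟ₗ-sound r₁ s₁ e₁)) (≟ₗ-sound r₂ s₂ e₂)
  where
  rest : (r₁ ≟ₗ s₁) ∧ (r₂ ≟ₗ s₂) ≡ true
  rest = ∧-conicalʳ (r₀ ≟ₗ s₀) _ h
  e₀ : (r₀ ≟ₗ s₀) ≡ true
  e₀ = ∧-conicalˡ (r₀ ≟ₗ s₀) _ h
  e₁ : (r₁ ≟ₗ s₁) ≡ true
  e₁ = ∧-conicalˡ (r₁ ≟ₗ s₁) _ rest
  e₂ : (r₂ ≟ₗ s₂) ≡ true
  e₂ = ∧-conicalʳ (r₁ ≟ₗ s₁) _ rest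

module _ (L : ℕ) where

  ⟦⊕²⟧ : ∀ t u v → ⟦ t ∣ L ⟧² (u ⊕² v) ≡ ⟦ t ∣ L ⟧² u + ⟦ t ∣ L ⟧² v
  ⟦⊕²⟧ t (lin² r₀ r₁ r₂) (lin² s₀ s₁ s₂) rewrite ⟦⊕⟧ L r₀ s₀ | ⟦⊕⟧ L r₁ s₁ | ⟦⊕⟧ L r₂ s₂ =
    solve 8 (λ x₀ y₀ x₁ y₁ x₂ y₂ A E → (x₀ :+ y₀) :+ A :* (x₁ :+ y₁) :+ E :* (x₂ :+ y₂)
                                       := (x₀ :+ A :* x₁ :+ E :* x₂) :+ (y₀ :+ A :* y₁ :+ E :* y₂))
      refl (⟦ L ⟧ r₀) (⟦ L ⟧ s₀) (⟦ L ⟧ r₁) (⟦ L ⟧ s₁) (⟦ L ⟧ r₂) (⟦ L ⟧ s₂) (φ t) (ψ t)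

  ⟦𝟘²⟧ : ∀ t → ⟦ t ∣ L ⟧² 𝟘² ≡ 0
  ⟦𝟘²⟧ t rewrite *-zeroʳ (φ t) | *-zeroʳ (ψ t) = refl

  ⟦advance²⟧ : ∀ t u → ⟦ suc t ∣ L ⟧² u ≡ ⟦ t ∣ L ⟧² (advance² u)
  ⟦advance²⟧ t (lin² r₀ r₁ r₂)
    rewrite ⟦⊕⟧ L (r₀ ⊕ r₁) r₂ | ⟦⊕⟧ L r₀ r₁ | ⟦⊕⟧ L r₁ r₂ | ⟦⊕⟧ L r₁ (r₂ ⊕ r₂) | ⟦⊕⟧ L r₂ r₂ =
    solve 5 (λ x₀ x₁ x₂ A E → x₀ :+ (A :+ E :+ con 1) :* x₁ :+ (A :+ con 2 :* E :+ con 1) :* x₂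
                             := (x₀ :+ x₁ :+ x₂) :+ A :* (x₁ :+ x₂) :+ E :* (x₁ :+ (x₂ :+ x₂)))
      refl (⟦ L ⟧ r₀) (⟦ L ⟧ r₁) (⟦ L ⟧ r₂) (φ t) (ψ t)

  ⟦⟧²-zero : ∀ u → ⟦ 0 ∣ L ⟧² u ≡ ⟦ L ⟧ (row₀ u)
  ⟦⟧²-zero (lin² r₀ r₁ r₂) = trans (+-identityʳ (⟦ L ⟧ r₀ + 0)) (+-identityʳ (⟦ L ⟧ r₀))

forestCoef² : Profile → Lin²
forestCoef² (profile true true true true true true) = lin² (lin 1 1 1) (lin 1 1 1) (lin 1 1 1)
forestCoef² (profile true true false true false false) = lin² (lin 0 0 0) (lin 0 0 0) (lin 0 0 0)
forestCoef² (profile true false true false true false) = lin² (lin 1 1 1) (lin 0 0 0) (lin 1 1 1)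
forestCoef² (profile true false false false false true) = lin² (lin 1 1 1) (lin 0 0 0) (lin 1 1 1)
forestCoef² (profile true false false false false false) = lin² (lin 0 0 0) (lin 0 0 0) (lin 0 0 0)
forestCoef² (profile false true true false false true) = lin² (lin 2 2 4) (lin 1 1 3) (lin 2 2 4)
forestCoef² (profile false true false false true false) = lin² (lin 2 2 4) (lin 1 1 3) (lin 2 2 4)
forestCoef² (profile false true false false false false) = lin² (lin 0 0 0) (lin 0 0 0) (lin 0 0 0)
forestCoef² (profile false false true true false false) = lin² (lin 1 1 3) (lin 1 1 3) (lin 3 3 5)
forestCoef² (profile false false true false false false) = lin² (lin 1 1 3) (lin 1 1 1) (lin 1 1 3)
forestCoef² (profile false false false true true true) = lin² (lin 1 1 3) (lin 1 1 3) (lin 3 3 5)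
forestCoef² (profile false false false true false false) = lin² (lin 0 0 0) (lin 0 0 0) (lin 0 0 0)
forestCoef² (profile false false false false true false) = lin² (lin 1 1 3) (lin 1 1 1) (lin 1 1 3)
forestCoef² (profile false false false false false true) = lin² (lin 1 1 3) (lin 1 1 1) (lin 1 1 3)
forestCoef² (profile false false false false false false) = lin² (lin 0 0 0) (lin 0 0 0) (lin 0 0 0)
forestCoef² _ = 𝟘²

satisfiesRecurrence² : Profile → Bool
satisfiesRecurrence² p = sumSteps _⊕²_ plainMove (onLive 𝟘² forestCoef²) (live p) ≟² advance² (forestCoef² p)

entersTarget : Profile → Bool
entersTarget p = row₀ (forestCoef² p) ≟ₗ sumSteps _⊕_ targetMove (onLive 𝟘 forestCoef) (live p)

forestCoef²-recurrence : allProfiles (onTransitive satisfiesRecurrence²) ≡ true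
forestCoef²-recurrence = refl

forestCoef²-initial : allProfiles (onTransitive entersTarget) ≡ true
forestCoef²-initial = refl

forest-before-target : ∀ L t p → transitive p ≡ true →
  transferⁿ t (transfer targetMove (transferⁿ L forestWeight)) (live p) ≡ ⟦ t ∣ L ⟧² (forestCoef² p)
forest-before-target L t p t-p = Solution.solution (λ t → ⟦ t ∣ L ⟧²) _⊕²_ 𝟘² advance² (⟦⊕²⟧ L) (⟦𝟘²⟧ L) (⟦advance²⟧ L)
  w₀ w₀-dead forestCoef² initial recurrence t (live p) t-p
  where
  w₀ : State → ℕ
  w₀ = transfer targetMove (transferⁿ L forestWeight)
  w₀-dead : w₀ dead ≡ 0
  w₀-dead rewrite transferⁿ-dead L forestWeight refl = refl
  initial : ∀ p → transitive p ≡ true → w₀ (live p) ≡ ⟦ 0 ∣ L ⟧² (forestCoef² p)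
  initial p t-p = begin
    sumSteps _+_ targetMove (transferⁿ L forestWeight) (live p)
      ≡⟨ cong₂ _+_ (cong₂ _+_ (after false false) (after false true)) (cong₂ _+_ (after true false) (after true true)) ⟩
    sumSteps _+_ targetMove (⟦ L ⟧ ∘′ onLive 𝟘 forestCoef) (live p)
      ≡⟨ sym (sumSteps-hom ⟦ L ⟧ _⊕_ (⟦⊕⟧ L) targetMove (onLive 𝟘 forestCoef) (live p)) ⟩
    ⟦ L ⟧ (sumSteps _⊕_ targetMove (onLive 𝟘 forestCoef) (live p))
      ≡⟨ cong ⟦ L ⟧ (sym (≟ₗ-sound (row₀ (forestCoef² p)) (sumSteps _⊕_ targetMove (onLive 𝟘 forestCoef) (live p)) (checked entersTarget forestCoef²-initial p t-p))) ⟩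
    ⟦ L ⟧ (row₀ (forestCoef² p))
      ≡⟨ sym (⟦⟧²-zero L (forestCoef² p)) ⟩
    ⟦ 0 ∣ L ⟧² (forestCoef² p) ∎
    where
    after : ∀ s r → transferⁿ L forestWeight (step targetMove s r (live p)) ≡ ⟦ L ⟧ (onLive 𝟘 forestCoef (step targetMove s r (live p)))
    after s r = forest-after-target L _ (preserves-sound targetMove p (checked (preserves targetMove) targetMove-preserves p t-p) s r)
  recurrence : ∀ p → transitive p ≡ true → sumSteps _⊕²_ plainMove (onLive 𝟘² forestCoef²) (live p) ≡ advance² (forestCoef² p)
  recurrence p t-p = ≟²-sound _ _ (checked satisfiesRecurrence² forestCoef²-recurrence p t-p)

-- The rotated wheel

segment : ∀ {A : Set} → (ℕ → A) → ℕ → ℕ → List A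
segment h a zero = []
segment h a (suc k) = h a ∷ segment h (suc a) k

segment-++ : ∀ {A : Set} (h : ℕ → A) a k l → segment h a (k + l) ≡ segment h a k ++ segment h (a + k) l
segment-++ h a zero l rewrite +-identityʳ a = refl
segment-++ h a (suc k) l rewrite +-suc a k = cong (h a ∷_) (segment-++ h (suc a) k l)

segment-cong : ∀ {A : Set} (h g : ℕ → A) a k → (∀ t → a ≤ t → t < a + k → h t ≡ g t) → segment h a k ≡ segment g a k
segment-cong h g a zero e = refl
segment-cong h g a (suc k) e = cong₂ _∷_ (e a ≤-refl (subst (a <_) (sym (+-suc a k)) (s≤s (m≤m+n a k))))
  (segment-cong h g (suc a) k (λ t a<t t< → e t (<⇒≤ a<t) (subst (t <_) (sym (+-suc a k)) t<)))

segment-shift : ∀ {A : Set} (h : ℕ → A) c a k → segment (λ t → h (c + t)) a k ≡ segment h (c + a) k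
segment-shift h c a zero = refl
segment-shift h c a (suc k) = cong (h (c + a) ∷_) (trans (segment-shift h c (suc a) k) (cong (λ z → segment h z k) (+-suc c a)))

segment-unshift : ∀ {A : Set} (h : ℕ → A) c a k → segment (λ t → h (t ∸ c)) (a + c) k ≡ segment h a k
segment-unshift h c a zero = refl
segment-unshift h c a (suc k) = cong₂ _∷_ (cong h (m+n∸n≡m a c)) (segment-unshift h c (suc a) k)

segment-snoc : ∀ {A : Set} (h : ℕ → A) a k → segment h a (suc k) ≡ segment h a k ++ (h (a + k) ∷ [])
segment-snoc h a k = trans (cong (segment h a) (+-comm 1 k)) (segment-++ h a k 1)

applyUpTo-segment : ∀ {A : Set} (G : ℕ → A) k a (f : ℕ → A) → (∀ m → f m ≡ G (a + m)) → applyUpTo f k ≡ segment G a k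
applyUpTo-segment G zero a f e = refl
applyUpTo-segment G (suc k) a f e = cong₂ _∷_ (trans (e 0) (cong G (+-identityʳ a)))
  (applyUpTo-segment G k (suc a) (λ m → f (suc m)) (λ m → trans (e (suc m)) (cong G (+-suc a m))))

∷↭++∷ʳ : ∀ {A : Set} (b : A) (X Y : List A) → b ∷ (X ++ Y) ↭ X ++ (Y ++ (b ∷ []))
∷↭++∷ʳ b X Y = subst (b ∷ (X ++ Y) ↭_) (++-assoc X Y (b ∷ [])) (∷↭∷ʳ b (X ++ Y))

-- The rim of W_{s+q+1} read cyclically from v_{s+1}: label t is the t-th vertex scanned.
module Rotation (s q : ℕ) (q≥1 : 1 ≤ q) where

  n : ℕ
  n = s + q

  label : ℕ → ℕ
  label t = if t ≤ᵇ q then s + t else t ∸ q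

  label-lo : ∀ {t} → t ≤ q → label t ≡ s + t
  label-lo le rewrite ≤⇒≤ᵇ′ le = refl

  label-hi : ∀ {t} → q < t → label t ≡ t ∸ q
  label-hi lt rewrite >⇒≤ᵇ-false lt = refl

  n≥1 : 1 ≤ n
  n≥1 = ≤-trans q≥1 (m≤n+m q s)

  suc-pred-n : suc (n ∸ 1) ≡ n
  suc-pred-n = trans (+-comm 1 (n ∸ 1)) (m∸n+n≡m n≥1)

  label-1 : label 1 ≡ s + 1
  label-1 = label-lo q≥1

  label-pos : ∀ {t} → 1 ≤ t → t ≤ n → 1 ≤ label t
  label-pos {t} 1≤t t≤n with t ≤? q
  ... | yes le rewrite label-lo le = ≤-trans 1≤t (m≤n+m t s)
  ... | no gt rewrite label-hi (≰⇒> gt) = m<n⇒0<n∸m (≰⇒> gt)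

  label≤n : ∀ {t} → t ≤ n → label t ≤ n
  label≤n {t} t≤n with t ≤? q
  ... | yes le rewrite label-lo le = +-monoʳ-≤ s le
  ... | no gt rewrite label-hi (≰⇒> gt) = ≤-trans (m∸n≤m t q) t≤n

  label≢0 : ∀ {t} → 1 ≤ t → t ≤ n → 0 ≢ label t
  label≢0 1≤t t≤n e = <-irrefl refl (≤-trans (label-pos 1≤t t≤n) (≤-reflexive (sym e)))

  label-injective : ∀ {t t′} → 1 ≤ t → t < t′ → t′ ≤ n → label t ≢ label t′
  label-injective {t} {t′} 1≤t t<t′ t′≤n with t ≤? q | t′ ≤? q
  ... | yes a | yes b rewrite label-lo a | label-lo b = <⇒≢ (+-monoʳ-< s t<t′)
  ... | no a | no b rewrite label-hi (≰⇒> a) | label-hi (≰⇒> b) = <⇒≢ (∸-monoˡ-< t<t′ (<⇒≤ (≰⇒> a)))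
  ... | yes a | no b rewrite label-lo a | label-hi (≰⇒> b) =
    >⇒≢ (≤-<-trans (subst (t′ ∸ q ≤_) (m+n∸n≡m s q) (∸-monoˡ-≤ q t′≤n))
                   (subst (_< s + t) (+-identityʳ s) (+-monoʳ-< s 1≤t)))
  ... | no a | yes b = ⊥-elim (a (≤-trans (<⇒≤ t<t′) b))

  ScanPosition : ℕ → Set
  ScanPosition j = Σ[ d ∈ ℕ ] 1 ≤ d × d < n × label (suc d) ≡ j × (∣ suc s - j ∣ ≡ d ⊎ ∣ suc s - j ∣ ≡ n ∸ d)

  scan-position-> : ∀ {j} → suc s < j → j ≤ n → ScanPosition j
  scan-position-> {j} i<j j≤n = d , m<n⇒0<n∸m i<j , d<n , label≡j , inj₁ (m≤n⇒∣m-n∣≡n∸m (<⇒≤ i<j))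
    where
    d : ℕ
    d = j ∸ suc s
    s+1+d≡j : s + suc d ≡ j
    s+1+d≡j = trans (+-suc s d) (m+[n∸m]≡n (<⇒≤ i<j))
    d<n : d < n
    d<n = ≤-trans (subst (suc d ≤_) s+1+d≡j (m≤n+m (suc d) s)) j≤n
    label≡j : label (suc d) ≡ j
    label≡j = trans (label-lo (+-cancelˡ-≤ s (suc d) q (subst (_≤ s + q) (sym s+1+d≡j) j≤n))) s+1+d≡j

  scan-position-< : ∀ {j} → 1 ≤ j → j < suc s → ScanPosition j
  scan-position-< {j} 1≤j j<i = d , 1≤d , d<n , label≡j , inj₂ (trans (m≤n⇒∣n-m∣≡n∸m (<⇒≤ j<i)) (sym n∸d≡D))
    where
    D : ℕ
    D = suc s ∸ j
    j+D≡i : j + D ≡ suc s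
    j+D≡i = m+[n∸m]≡n (<⇒≤ j<i)
    i≤n : suc s ≤ n
    i≤n = subst (_≤ n) (+-comm s 1) (+-monoʳ-≤ s q≥1)
    D≤n : D ≤ n
    D≤n = ≤-trans (m∸n≤m (suc s) j) i≤n
    d : ℕ
    d = n ∸ D
    d+D≡n : d + D ≡ n
    d+D≡n = m∸n+n≡m D≤n
    n∸d≡D : n ∸ d ≡ D
    n∸d≡D = m∸[m∸n]≡n D≤n
    1≤d : 1 ≤ d
    1≤d = ≤-trans 1≤j (+-cancelʳ-≤ D j d (≤-trans (≤-reflexive j+D≡i) (subst (suc s ≤_) (sym d+D≡n) i≤n)))
    d<n : d < n
    d<n = subst (d <_) d+D≡n (subst (_≤ d + D) (+-comm d 1) (+-monoʳ-≤ d (m<n⇒0<n∸m j<i)))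
    1+d≡q+j : suc d ≡ q + j
    1+d≡q+j = +-cancelʳ-≡ D _ _ (begin
      suc d + D        ≡⟨ cong suc d+D≡n ⟩
      suc (s + q)      ≡⟨ cong suc (+-comm s q) ⟩
      suc q + s        ≡⟨ sym (+-suc q s) ⟩
      q + suc s        ≡⟨ cong (q +_) (sym j+D≡i) ⟩
      q + (j + D)      ≡⟨ sym (+-assoc q j D) ⟩
      q + j + D ∎)
    label≡j : label (suc d) ≡ j
    label≡j = trans (label-hi (subst (q <_) (sym 1+d≡q+j) (subst (_≤ q + j) (+-comm q 1) (+-monoʳ-≤ q 1≤j))))
                    (trans (cong (_∸ q) 1+d≡q+j) (m+n∸m≡n q j))

  scan-position : ∀ j → 1 ≤ j → j ≤ n → suc s ≢ j → ScanPosition j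
  scan-position j 1≤j j≤n i≢j with <-cmp (suc s) j
  ... | tri≈ _ eq _ = ⊥-elim (i≢j eq)
  ... | tri< i<j _ _ = scan-position-> i<j j≤n
  ... | tri> _ _ j<i = scan-position-< 1≤j j<i

  rimEdge : ℕ → Edge
  rimEdge v = if v <ᵇ n then (v , suc v) else (n , 1)

  rimEdge-< : ∀ {v} → v < n → rimEdge v ≡ (v , suc v)
  rimEdge-< lt rewrite <⇒<ᵇ′ lt = refl

  rimEdge-n : rimEdge n ≡ (n , 1)
  rimEdge-n rewrite ≥⇒<ᵇ-false {n} {n} ≤-refl = refl

  rimEdge-label : ∀ {t} → 1 ≤ t → t < n → rimEdge (label t) ≡ (label t , label (suc t))
  rimEdge-label {t} 1≤t t<n with t ≤? q
  ... | no a rewrite label-hi (≰⇒> a) | label-hi (m<n⇒m<1+n (≰⇒> a)) | +-∸-assoc 1 (<⇒≤ (≰⇒> a)) =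
    rimEdge-< (≤-<-trans (m∸n≤m t q) t<n)
  ... | yes a with m≤n⇒m<n∨m≡n a
  ... | inj₁ lt rewrite label-lo a | label-lo lt | +-suc s t = rimEdge-< (+-monoʳ-< s lt)
  ... | inj₂ refl rewrite label-lo a | label-hi (n<1+n q) | m+n∸n≡m 1 q = rimEdge-n

  rimEdge-label-n : rimEdge (label n) ≡ (label n , label 1)
  rimEdge-label-n with q <? n
  ... | yes lt rewrite label-hi lt | m+n∸n≡m s q | label-1 | +-comm s 1 =
    rimEdge-< (subst (_< n) (+-identityʳ s) (+-monoʳ-< s q≥1))
  ... | no q≮n = trans (cong rimEdge label-n≡n) (trans rimEdge-n (cong₂ _,_ (sym label-n≡n) (sym label-1≡1)))
    where
    s≡0 : s ≡ 0
    s≡0 = n≤0⇒n≡0 (+-cancelʳ-≤ q s 0 (≮⇒≥ q≮n))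
    label-n≡n : label n ≡ n
    label-n≡n = trans (label-lo {n} (≮⇒≥ q≮n)) (cong (_+ n) s≡0)
    label-1≡1 : label 1 ≡ 1
    label-1≡1 = trans label-1 (cong (_+ 1) s≡0)

  rotate : ∀ {A : Set} (h : ℕ → A) → segment (λ t → h (label t)) 1 n ↭ segment h 1 n
  rotate h = subst (_↭ segment h 1 n) (sym rotated) (subst (segment h (s + 1) q ++ segment h 1 s ↭_) joined
               (++-comm (segment h (s + 1) q) (segment h 1 s)))
    where
    low : segment (λ t → h (label t)) 1 q ≡ segment h (s + 1) q
    low = trans (segment-cong _ _ 1 q (λ t _ t<1+q → cong h (label-lo (≤-pred t<1+q)))) (segment-shift h s 1 q)
    high : segment (λ t → h (label t)) (1 + q) s ≡ segment h 1 s
    high = trans (segment-cong _ _ (1 + q) s (λ t q<t _ → cong h (label-hi q<t))) (segment-unshift h q 1 s)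
    rotated : segment (λ t → h (label t)) 1 n ≡ segment h (s + 1) q ++ segment h 1 s
    rotated = trans (cong (segment _ 1) (+-comm s q)) (trans (segment-++ _ 1 q s) (cong₂ _++_ low high))
    joined : segment h 1 s ++ segment h (s + 1) q ≡ segment h 1 n
    joined = trans (cong (λ z → segment h 1 s ++ segment h z q) (+-comm s 1)) (sym (segment-++ h 1 s q))

  spoke : ℕ → Edge
  spoke v = (0 , v)

  wheelEdges-segments : wheelEdges n ≡ segment spoke 1 n ++ segment rimEdge 1 n
  wheelEdges-segments = cong₂ _++_ spokes≡ (begin
    rimPath n ++ ((n , 1) ∷ [])
      ≡⟨ cong₂ _++_ rimPath≡ (cong (_∷ []) (trans (sym rimEdge-n) (cong rimEdge (sym suc-pred-n)))) ⟩
    segment rimEdge 1 (n ∸ 1) ++ (rimEdge (1 + (n ∸ 1)) ∷ [])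
      ≡⟨ sym (segment-snoc rimEdge 1 (n ∸ 1)) ⟩
    segment rimEdge 1 (suc (n ∸ 1))
      ≡⟨ cong (segment rimEdge 1) suc-pred-n ⟩
    segment rimEdge 1 n ∎)
    where
    spokes≡ : spokes n ≡ segment spoke 1 n
    spokes≡ = trans (map-applyUpTo (λ z → z) (λ m → (0 , suc m)) n) (applyUpTo-segment spoke n 1 _ (λ m → refl))
    rimPath≡ : rimPath n ≡ segment rimEdge 1 (n ∸ 1)
    rimPath≡ = trans (map-applyUpTo (λ z → z) (λ m → (suc m , suc (suc m))) (n ∸ 1))
      (trans (applyUpTo-segment (λ v → (v , suc v)) (n ∸ 1) 1 _ (λ m → refl))
             (segment-cong _ _ 1 (n ∸ 1) (λ t _ t< → sym (rimEdge-< (subst (t <_) suc-pred-n t<)))))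

  scanned : ℕ → List Edge
  scanned zero = []
  scanned (suc zero) = (0 , label 1) ∷ []
  scanned (suc (suc m)) = (0 , label (suc (suc m))) ∷ (label (suc m) , label (suc (suc m))) ∷ scanned (suc m)

  closingEdge : Edge
  closingEdge = (label n , label 1)

  scanned-segments : ∀ m → scanned (suc m) ↭ segment (spoke ∘ label) 1 (suc m) ++ segment (λ t → (label t , label (suc t))) 1 m
  scanned-segments zero = ↭.refl
  scanned-segments (suc m) =
    ↭-trans (prep sp (prep rm (scanned-segments m)))
    (↭-trans (prep sp (∷↭++∷ʳ rm spokesₘ rimsₘ))
    (↭-trans (↭-sym (shift sp spokesₘ (rimsₘ ++ (rm ∷ []))))
             (subst (spokesₘ ++ (sp ∷ (rimsₘ ++ (rm ∷ []))) ↭_) regroup ↭-refl)))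
    where
    sp rm : Edge
    sp = spoke (label (suc (suc m)))
    rm = (label (suc m) , label (suc (suc m)))
    spokesₘ rimsₘ : List Edge
    spokesₘ = segment (spoke ∘ label) 1 (suc m)
    rimsₘ = segment (λ t → (label t , label (suc t))) 1 m
    regroup : spokesₘ ++ (sp ∷ (rimsₘ ++ (rm ∷ []))) ≡ segment (spoke ∘ label) 1 (suc (suc m)) ++ segment (λ t → (label t , label (suc t))) 1 (suc m)
    regroup = trans (sym (++-assoc spokesₘ (sp ∷ []) (rimsₘ ++ (rm ∷ []))))
              (cong₂ _++_ (sym (segment-snoc (spoke ∘ label) 1 (suc m))) (sym (segment-snoc _ 1 m)))

  scan-↭-wheelEdges : closingEdge ∷ scanned n ↭ wheelEdges n
  scan-↭-wheelEdges =
    ↭-trans (prep closingEdge scanned-n)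
    (↭-trans (∷↭++∷ʳ closingEdge (segment (spoke ∘ label) 1 n) (segment (λ t → (label t , label (suc t))) 1 (n ∸ 1)))
    (subst (segment (spoke ∘ label) 1 n ++ (segment (λ t → (label t , label (suc t))) 1 (n ∸ 1) ++ (closingEdge ∷ [])) ↭_)
           (sym wheelEdges-segments)
           (subst (λ z → segment (spoke ∘ label) 1 n ++ z ↭ segment spoke 1 n ++ segment rimEdge 1 n) (sym rims≡)
                  (++⁺ (rotate spoke) (rotate rimEdge)))))
    where
    scanned-n : scanned n ↭ segment (spoke ∘ label) 1 n ++ segment (λ t → (label t , label (suc t))) 1 (n ∸ 1)
    scanned-n = subst (λ z → scanned z ↭ segment (spoke ∘ label) 1 z ++ segment (λ t → (label t , label (suc t))) 1 (n ∸ 1))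
                      suc-pred-n (scanned-segments (n ∸ 1))
    rims≡ : segment (λ t → (label t , label (suc t))) 1 (n ∸ 1) ++ (closingEdge ∷ []) ≡ segment (λ t → rimEdge (label t)) 1 n
    rims≡ = trans (cong₂ _++_ (segment-cong _ _ 1 (n ∸ 1) (λ t 1≤t t< → sym (rimEdge-label 1≤t (subst (t <_) suc-pred-n t<))))
                             (cong (_∷ []) (trans (sym rimEdge-label-n) (cong (λ z → rimEdge (label z)) (sym suc-pred-n)))))
            (trans (sym (segment-snoc (λ t → rimEdge (label t)) 1 (n ∸ 1))) (cong (segment (λ t → rimEdge (label t)) 1) suc-pred-n))

-- Scanning the wheel

opt : ∀ {X : Set} → Bool → X → List X → List X
opt true e T = e ∷ T
opt false e T = T

module Tracking (V : List ℕ) (uniq : Unique V) where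

  open Components V uniq

  profileOf : List Edge → (Slot → ℕ) → Profile
  profileOf T ρ = profile (connected V T (ρ centre) (ρ start)) (connected V T (ρ centre) (ρ last))
    (connected V T (ρ centre) (ρ target)) (connected V T (ρ start) (ρ last))
    (connected V T (ρ start) (ρ target)) (connected V T (ρ last) (ρ target))

  Tracks : List Edge → (Slot → ℕ) → SlotRel → Set
  Tracks T ρ P = ∀ x y → connected V T (ρ x) (ρ y) ≡ P x y

  TracksTracked : List Edge → (Slot → ℕ) → SlotRel → Set
  TracksTracked T ρ P = ∀ x y → x ∈ tracked → y ∈ tracked → connected V T (ρ x) (ρ y) ≡ P x y

  SlotsIn : (Slot → ℕ) → Set
  SlotsIn ρ = ∀ x → ρ x ∈ V

  components-∷ : ∀ S a b {c} → Closed V ((a , b) ∷ S) → connected V S a b ≡ c →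
    components V ((a , b) ∷ S) + toℕ (not c) ≡ components V S
  components-∷ S a b {true} cl e = trans (+-identityʳ _) (components-∷-connected S a b cl e)
  components-∷ S a b {false} cl e = trans (+-comm _ 1) (sym (components-∷-disconnected S a b cl e))

  acyclic-∷′ : ∀ S a b {c} → Closed V ((a , b) ∷ S) → connected V S a b ≡ c →
    acyclic V ((a , b) ∷ S) ≡ not c ∧ acyclic V S
  acyclic-∷′ S a b cl e = trans (acyclic-∷ V S a b cl) (cong (λ z → not z ∧ acyclic V S) e)

  connected-refl : ∀ {T v} → Closed V T → v ∈ V → connected V T v v ≡ true
  connected-refl cl v∈V = Path⇒connected cl v∈V []

  connected-sym : ∀ {T a b} → Closed V T → a ∈ V → b ∈ V → connected V T a b ≡ connected V T b a
  connected-sym {T} {a} {b} cl a∈V b∈V =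
    bool-ext (Path⇒connected cl a∈V ∘ reverse ∘ connected⇒Path V T a b) (Path⇒connected cl b∈V ∘ reverse ∘ connected⇒Path V T b a)

  tracks-fresh : ∀ {T ρ} → Closed V T → SlotsIn ρ → Isolated (ρ fresh) T → (∀ x → x ≢ fresh → ρ x ≢ ρ fresh) →
    Tracks T ρ (relation (profileOf T ρ))
  tracks-fresh {T} {ρ} cl ρ∈V iso distinct = go
    where
    sy : ∀ x y → connected V T (ρ x) (ρ y) ≡ connected V T (ρ y) (ρ x)
    sy x y = connected-sym cl (ρ∈V x) (ρ∈V y)
    rf : ∀ x → connected V T (ρ x) (ρ x) ≡ true
    rf x = connected-refl cl (ρ∈V x)
    to-fresh : ∀ x → x ≢ fresh → connected V T (ρ x) (ρ fresh) ≡ false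
    to-fresh x x≢f = ¬-not λ h → distinct x x≢f (path-to-isolated iso (connected⇒Path V T _ _ h))
    go : Tracks T ρ (relation (profileOf T ρ))
    go fresh fresh = rf fresh
    go centre fresh = to-fresh centre λ ()
    go start fresh = to-fresh start λ ()
    go last fresh = to-fresh last λ ()
    go target fresh = to-fresh target λ ()
    go fresh centre = trans (sy fresh centre) (to-fresh centre λ ())
    go fresh start = trans (sy fresh start) (to-fresh start λ ())
    go fresh last = trans (sy fresh last) (to-fresh last λ ())
    go fresh target = trans (sy fresh target) (to-fresh target λ ())
    go centre centre = rf centre
    go centre start = refl
    go centre last = refl
    go centre target = refl
    go start centre = sy start centre
    go start start = rf start
    go start last = refl
    go start target = refl
    go last centre = sy last centre
    go last start = sy last start
    go last last = rf last
    go last target = refl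
    go target centre = sy target centre
    go target start = sy target start
    go target last = sy target last
    go target target = rf target

  tracks-profileOf : ∀ {T ρ} → Closed V T → SlotsIn ρ → TracksTracked T ρ (relation (profileOf T ρ))
  tracks-profileOf {T} {ρ} cl ρ∈V = go
    where
    sy : ∀ x y → connected V T (ρ x) (ρ y) ≡ connected V T (ρ y) (ρ x)
    sy x y = connected-sym cl (ρ∈V x) (ρ∈V y)
    rf : ∀ x → connected V T (ρ x) (ρ x) ≡ true
    rf x = connected-refl cl (ρ∈V x)
    go : TracksTracked T ρ (relation (profileOf T ρ))
    go centre centre _ _ = rf centre
    go centre start _ _ = refl
    go centre last _ _ = refl
    go centre target _ _ = refl
    go start centre _ _ = sy start centre
    go start start _ _ = rf start
    go start last _ _ = refl
    go start target _ _ = refl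
    go last centre _ _ = sy last centre
    go last start _ _ = sy last start
    go last last _ _ = rf last
    go last target _ _ = refl
    go target centre _ _ = sy target centre
    go target start _ _ = sy target start
    go target last _ _ = sy target last
    go target target _ _ = rf target
    go fresh _ f∈ _ = ⊥-elim (fresh∉tracked f∈)
    go _ fresh _ f∈ = ⊥-elim (fresh∉tracked f∈)

  profileOf-transitive : ∀ {T ρ} → Closed V T → SlotsIn ρ → transitive (profileOf T ρ) ≡ true
  profileOf-transitive {T} {ρ} cl ρ∈V =
    all-intro _ tracked λ {x} x∈ → all-intro _ tracked λ {y} y∈ → all-intro _ tracked λ {z} z∈ → trans-at x y z x∈ y∈ z∈
    where
    Q : SlotRel
    Q = relation (profileOf T ρ)
    tr : TracksTracked T ρ Q
    tr = tracks-profileOf cl ρ∈V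
    trans-at : ∀ x y z → x ∈ tracked → y ∈ tracked → z ∈ tracked → (not (Q x y ∧ Q y z) ∨ Q x z) ≡ true
    trans-at x y z x∈ y∈ z∈ with Q x y in xy | Q y z in yz
    ... | false | _ = refl
    ... | true | false = refl
    ... | true | true rewrite sym (tr x z x∈ z∈) =
      Path⇒connected cl (ρ∈V z) (connected⇒Path V T _ _ (trans (tr x y x∈ y∈) xy) ++ₚ connected⇒Path V T _ _ (trans (tr y z y∈ z∈) yz))

  module _ (T : List Edge) (ρ : Slot → ℕ) (u v : Slot) (cl : Closed V ((ρ u , ρ v) ∷ T)) (ρ∈V : SlotsIn ρ) where

    tracks-link : ∀ {P} → Tracks T ρ P → Tracks ((ρ u , ρ v) ∷ T) ρ (link u v P)
    tracks-link tr x y = trans (connected-∷ V T (ρ u) (ρ v) (ρ x) (ρ y) cl (ρ∈V x) (ρ∈V y))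
      (cong₂ _∨_ (tr x y) (cong₂ _∨_ (cong₂ _∧_ (tr x u) (tr v y)) (cong₂ _∧_ (tr x v) (tr u y))))

    tracksTracked-link : ∀ {P} → u ∈ tracked → v ∈ tracked → TracksTracked T ρ P →
      TracksTracked ((ρ u , ρ v) ∷ T) ρ (link u v P)
    tracksTracked-link u∈ v∈ tr x y x∈ y∈ = trans (connected-∷ V T (ρ u) (ρ v) (ρ x) (ρ y) cl (ρ∈V x) (ρ∈V y))
      (cong₂ _∨_ (tr x y x∈ y∈) (cong₂ _∨_ (cong₂ _∧_ (tr x u x∈ u∈) (tr v y v∈ y∈)) (cong₂ _∧_ (tr x v x∈ v∈) (tr u y u∈ y∈))))

  scanEdges : (Slot → ℕ) → Bool → Bool → List Edge → List Edge
  scanEdges ρ s r T = opt s (ρ centre , ρ fresh) (opt r (ρ last , ρ fresh) T)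

  scan-tracks : ∀ T ρ p s r → Closed V (scanEdges ρ s r T) → SlotsIn ρ → Tracks T ρ (relation p) →
    Tracks (scanEdges ρ s r T) ρ (afterStep p s r)
    × components V (scanEdges ρ s r T) + merges p s r ≡ components V T
    × acyclic V (scanEdges ρ s r T) ≡ not (closesCycle p s r) ∧ acyclic V T
  scan-tracks T ρ p false false cl ρ∈V tr = tr , +-identityʳ _ , refl
  scan-tracks T ρ p false true cl ρ∈V tr =
    tracks-link T ρ last fresh cl ρ∈V tr ,
    trans (cong (components V ((ρ last , ρ fresh) ∷ T) +_) (+-identityʳ _)) (components-∷ T _ _ cl (tr last fresh)) ,
    trans (acyclic-∷′ T _ _ cl (tr last fresh)) (cong (λ z → not z ∧ acyclic V T) (sym (∨-identityʳ _)))
  scan-tracks T ρ p true false cl ρ∈V tr =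
    tracks-link T ρ centre fresh cl ρ∈V tr , components-∷ T _ _ cl (tr centre fresh) , acyclic-∷′ T _ _ cl (tr centre fresh)
  scan-tracks T ρ p true true cl ρ∈V tr =
    tracks-link T₁ ρ centre fresh cl ρ∈V tr₁ , counted , trans (acyclic-∷′ T₁ _ _ cl (tr₁ centre fresh)) both-acyclic
    where
    T₁ : List Edge
    T₁ = (ρ last , ρ fresh) ∷ T
    cl₁ : Closed V T₁
    cl₁ = cl ∘ there
    tr₁ : Tracks T₁ ρ (afterRim p true)
    tr₁ = tracks-link T ρ last fresh cl₁ ρ∈V tr
    m₁ m₂ : ℕ
    m₁ = toℕ (not (relation p last fresh))
    m₂ = toℕ (not (afterRim p true centre fresh))
    counted : components V ((ρ centre , ρ fresh) ∷ T₁) + (m₁ + m₂) ≡ components V T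
    counted = trans (solve 3 (λ c a b → c :+ (a :+ b) := (c :+ b) :+ a) refl (components V (scanEdges ρ true true T)) m₁ m₂)
                    (trans (cong (_+ m₁) (components-∷ T₁ _ _ cl (tr₁ centre fresh))) (components-∷ T _ _ cl₁ (tr last fresh)))
    both-acyclic : not (afterRim p true centre fresh) ∧ acyclic V T₁ ≡ not (closesCycle p true true) ∧ acyclic V T
    both-acyclic = trans (cong (not (afterRim p true centre fresh) ∧_) (acyclic-∷′ T _ _ cl₁ (tr last fresh)))
                         (regroup (afterRim p true centre fresh) (relation p last fresh) (acyclic V T))
      where
      regroup : ∀ a b c → not a ∧ (not b ∧ c) ≡ not ((true ∧ b) ∨ (true ∧ a)) ∧ c
      regroup true b c with b
      ... | true = refl
      ... | false = refl
      regroup false true c = refl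
      regroup false false c = refl

  close-tracks : ∀ T ρ p c → Closed V (opt c (ρ last , ρ start) T) → SlotsIn ρ → TracksTracked T ρ (relation p) →
    TracksTracked (opt c (ρ last , ρ start) T) ρ (afterClose p c)
    × components V (opt c (ρ last , ρ start) T) + mergesᶜ p c ≡ components V T
    × acyclic V (opt c (ρ last , ρ start) T) ≡ not (closesCycleᶜ p c) ∧ acyclic V T
  close-tracks T ρ p false cl ρ∈V tr = tr , +-identityʳ _ , refl
  close-tracks T ρ p true cl ρ∈V tr =
    tracksTracked-link T ρ last start cl ρ∈V last∈ start∈ tr ,
    components-∷ T _ _ cl (tr last start last∈ start∈) ,
    acyclic-∷′ T _ _ cl (tr last start last∈ start∈)

∈-sublists-∷ : ∀ {x : Edge} {xs T} → T ∈ sublists (x ∷ xs) → Σ[ b ∈ Bool ] Σ[ T₀ ∈ List Edge ] T₀ ∈ sublists xs × T ≡ opt b x T₀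
∈-sublists-∷ {x} {xs} m with ∈-++⁻ (sublists xs) m
... | inj₁ k = false , _ , k , refl
... | inj₂ k with ∈-map⁻ (x ∷_) k
... | T₀ , k₀ , refl = true , T₀ , k₀ , refl

∈-sublists⇒⊆ : ∀ L {T} → T ∈ sublists L → T ⊆ L
∈-sublists⇒⊆ [] (here refl) ()
∈-sublists⇒⊆ (x ∷ xs) m k with ∈-sublists-∷ {x} {xs} m
... | false , T₀ , k₀ , refl = there (∈-sublists⇒⊆ xs k₀ k)
... | true , T₀ , k₀ , refl with k
... | here refl = here refl
... | there k′ = there (∈-sublists⇒⊆ xs k₀ k′)

-- v_j is scanned as the (d+1)-th rim vertex.
module Scan (s q : ℕ) (q≥1 : 1 ≤ q) (d : ℕ) (d≥1 : 1 ≤ d) where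

  open Rotation s q q≥1

  V : List ℕ
  V = upTo (suc n)

  open Tracking V (upTo⁺ (suc n))

  vertex∈ : ∀ {v} → v ≤ n → v ∈ V
  vertex∈ le = ∈-upTo⁺ (s≤s le)

  ScannedEdge : ℕ → Edge → Set
  ScannedEdge m e = (Σ[ t ∈ ℕ ] (1 ≤ t × t ≤ m) × e ≡ (0 , label t))
                  ⊎ (Σ[ t ∈ ℕ ] (1 ≤ t × suc t ≤ m) × e ≡ (label t , label (suc t)))

  scanned-edge : ∀ m {e} → e ∈ scanned m → ScannedEdge m e
  scanned-edge (suc zero) (here refl) = inj₁ (1 , (≤-refl , ≤-refl) , refl)
  scanned-edge (suc (suc m)) (here refl) = inj₁ (suc (suc m) , (s≤s z≤n , ≤-refl) , refl)
  scanned-edge (suc (suc m)) (there (here refl)) = inj₂ (suc m , (s≤s z≤n , ≤-refl) , refl)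
  scanned-edge (suc (suc m)) (there (there k)) with scanned-edge (suc m) k
  ... | inj₁ (t , (a , b) , e) = inj₁ (t , (a , m≤n⇒m≤1+n b) , e)
  ... | inj₂ (t , (a , b) , e) = inj₂ (t , (a , m≤n⇒m≤1+n b) , e)

  scanned-closed : ∀ m → m ≤ n → Closed V (scanned m)
  scanned-closed m m≤n k with scanned-edge m k
  ... | inj₁ (t , (a , b) , refl) = vertex∈ z≤n , vertex∈ (label≤n (≤-trans b m≤n))
  ... | inj₂ (t , (a , b) , refl) = vertex∈ (label≤n (≤-trans (n≤1+n t) (≤-trans b m≤n))) , vertex∈ (label≤n (≤-trans b m≤n))

  next-isolated : ∀ m → suc m ≤ n → Isolated (label (suc m)) (scanned m)
  next-isolated m m<n k with scanned-edge m k
  ... | inj₁ (t , (a , b) , refl) = label≢0 (s≤s z≤n) m<n , label-injective a (s≤s b) m<n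
  ... | inj₂ (t , (a , b) , refl) = label-injective a (m≤n⇒m≤1+n b) m<n , label-injective (s≤s z≤n) (s≤s b) m<n

  targetVertex : ℕ → ℕ
  targetVertex m = if m ≤ᵇ d then 0 else label (suc d)

  targetVertex-≤ : ∀ {m} → m ≤ d → targetVertex m ≡ 0
  targetVertex-≤ le rewrite ≤⇒≤ᵇ′ le = refl

  targetVertex-> : ∀ {m} → d < m → targetVertex m ≡ label (suc d)
  targetVertex-> lt rewrite >⇒≤ᵇ-false lt = refl

  targetVertex≤n : ∀ m → m ≤ n → targetVertex m ≤ n
  targetVertex≤n m m≤n with m ≤? d
  ... | yes le rewrite targetVertex-≤ le = z≤n
  ... | no gt rewrite targetVertex-> (≰⇒> gt) = label≤n (≤-trans (≰⇒> gt) m≤n)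

  -- roles m: the slots once m rim vertices are scanned.
  roles : ℕ → Slot → ℕ
  roles m centre = 0
  roles zero start = 0
  roles (suc m) start = label 1
  roles zero last = 0
  roles (suc m) last = label (suc m)
  roles m target = targetVertex m
  roles m fresh = label (suc m)

  moveAt : ℕ → Move
  moveAt zero = firstMove
  moveAt (suc m) = if suc m ≡ᵇ d then targetMove else plainMove

  moveAt-counts : ∀ m → allProfiles (onTransitive (stepCount (moveAt m))) ≡ true
  moveAt-counts zero = firstMove-counts
  moveAt-counts (suc m) with suc m ≡ᵇ d
  ... | true = targetMove-counts
  ... | false = plainMove-counts

  roles-suc : ∀ m x → x ∈ tracked → roles (suc m) x ≡ roles m (moveAt m x)
  roles-suc zero centre _ = refl
  roles-suc zero start _ = refl
  roles-suc zero last _ = refl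
  roles-suc zero target _ = targetVertex-≤ d≥1
  roles-suc zero fresh f∈ = ⊥-elim (fresh∉tracked f∈)
  roles-suc (suc m) x x∈ with suc m ≡ᵇ d in eq
  ... | true = at-target x x∈
    where
    m+1≡d : suc m ≡ d
    m+1≡d = ≡ᵇ⇒≡′ eq
    at-target : ∀ x → x ∈ tracked → roles (suc (suc m)) x ≡ roles (suc m) (targetMove x)
    at-target centre _ = refl
    at-target start _ = refl
    at-target last _ = refl
    at-target target _ = trans (targetVertex-> (≤-reflexive (cong suc (sym m+1≡d)))) (cong (label ∘ suc) (sym m+1≡d))
    at-target fresh f∈ = ⊥-elim (fresh∉tracked f∈)
  ... | false = elsewhere x x∈
    where
    m+1≢d : suc m ≢ d
    m+1≢d e = true≢false (trans (cong (suc m ≡ᵇ_) (sym e)) (≡ᵇ-refl (suc m))) eq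
    elsewhere : ∀ x → x ∈ tracked → roles (suc (suc m)) x ≡ roles (suc m) (plainMove x)
    elsewhere centre _ = refl
    elsewhere start _ = refl
    elsewhere last _ = refl
    elsewhere target _ with suc m ≤? d
    ... | yes le = trans (targetVertex-≤ (≤∧≢⇒< le m+1≢d)) (sym (targetVertex-≤ le))
    ... | no gt = trans (targetVertex-> (m<n⇒m<1+n (≰⇒> gt))) (sym (targetVertex-> (≰⇒> gt)))
    elsewhere fresh f∈ = ⊥-elim (fresh∉tracked f∈)

  roles∈V : ∀ m → suc m ≤ n → SlotsIn (roles m)
  roles∈V m m<n centre = vertex∈ z≤n
  roles∈V zero m<n start = vertex∈ z≤n
  roles∈V (suc m) m<n start = vertex∈ (label≤n (≤-trans (s≤s z≤n) m<n))
  roles∈V zero m<n last = vertex∈ z≤n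
  roles∈V (suc m) m<n last = vertex∈ (label≤n (≤-trans (n≤1+n (suc m)) m<n))
  roles∈V m m<n target = vertex∈ (targetVertex≤n m (≤-trans (n≤1+n m) m<n))
  roles∈V m m<n fresh = vertex∈ (label≤n m<n)

  roles-distinct : ∀ m → suc m ≤ n → ∀ x → x ≢ fresh → roles m x ≢ roles m fresh
  roles-distinct m m<n centre _ = label≢0 (s≤s z≤n) m<n
  roles-distinct zero m<n start _ = label≢0 (s≤s z≤n) m<n
  roles-distinct (suc m) m<n start _ = label-injective ≤-refl (s≤s (s≤s z≤n)) m<n
  roles-distinct zero m<n last _ = label≢0 (s≤s z≤n) m<n
  roles-distinct (suc m) m<n last _ = label-injective (s≤s z≤n) ≤-refl m<n
  roles-distinct m m<n target _ with m ≤? d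
  ... | yes le rewrite targetVertex-≤ le = label≢0 (s≤s z≤n) m<n
  ... | no gt rewrite targetVertex-> (≰⇒> gt) = label-injective (s≤s z≤n) (s≤s (≰⇒> gt)) m<n
  roles-distinct m m<n fresh x≢f = ⊥-elim (x≢f refl)

  ∈-opt : ∀ b (x : Edge) T {e} → e ∈ opt b x T → e ≡ x ⊎ e ∈ T
  ∈-opt true x T (here refl) = inj₁ refl
  ∈-opt true x T (there k) = inj₂ k
  ∈-opt false x T k = inj₂ k

  scanEdges-⊆ : ∀ m {T} → T ⊆ scanned m → ∀ s r → scanEdges (roles m) s r T ⊆ scanned (suc m)
  scanEdges-⊆ m T⊆ s r k with ∈-opt s _ _ k
  ... | inj₁ refl = spoke∈ m
    where
    spoke∈ : ∀ m → (0 , label (suc m)) ∈ scanned (suc m)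
    spoke∈ zero = here refl
    spoke∈ (suc m) = here refl
  ... | inj₂ k′ with ∈-opt r _ _ k′
  ... | inj₁ refl = rim∈ m
    where
    rim∈ : ∀ m → (roles m last , label (suc m)) ∈ scanned (suc m)
    rim∈ zero = here refl
    rim∈ (suc m) = there (here refl)
  ... | inj₂ k″ = earlier m (T⊆ k″)
    where
    earlier : ∀ m → scanned m ⊆ scanned (suc m)
    earlier (suc m) = there ∘ there

  stateAt : ℕ → List Edge → State
  stateAt m T = stateOf (acyclic V T) (components V T) (n ∸ m) (profileOf T (roles m))

  Invariant : ℕ → List Edge → Set
  Invariant m T = (n ∸ m) + classes (profileOf T (roles m)) ≤ components V T

  profile-cong : ∀ {a a′ b b′ c c′ d d′ e e′ f f′} → a ≡ a′ → b ≡ b′ → c ≡ c′ → d ≡ d′ → e ≡ e′ → f ≡ f′ →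
    profile a b c d e f ≡ profile a′ b′ c′ d′ e′ f′
  profile-cong refl refl refl refl refl refl = refl

  profileOf-moved : ∀ {T ρ ρ₀ σ P} → (∀ x → x ∈ tracked → ρ x ≡ ρ₀ (σ x)) → Tracks T ρ₀ P → profileOf T ρ ≡ restrict σ P
  profileOf-moved {T} {ρ} {ρ₀} {σ} {P} moved tr =
    profile-cong (pair centre start centre∈ start∈) (pair centre last centre∈ last∈) (pair centre target centre∈ target∈)
                 (pair start last start∈ last∈) (pair start target start∈ target∈) (pair last target last∈ target∈)
    where
    pair : ∀ x y → x ∈ tracked → y ∈ tracked → connected V T (ρ x) (ρ y) ≡ P (σ x) (σ y)
    pair x y x∈ y∈ = trans (cong₂ (connected V T) (moved x x∈) (moved y y∈)) (tr (σ x) (σ y))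

  scan-step : ∀ m → suc m ≤ n → ∀ T → T ⊆ scanned m → Invariant m T → ∀ s r →
    Invariant (suc m) (scanEdges (roles m) s r T) × stateAt (suc m) (scanEdges (roles m) s r T) ≡ step (moveAt m) s r (stateAt m T)
  scan-step m m<n T T⊆ inv s r =
    subst (λ z → (n ∸ suc m) + classes z ≤ components V T′) (sym moved) (proj₁ result) ,
    trans (cong (stateOf (acyclic V T′) (components V T′) (n ∸ suc m)) moved)
          (trans (proj₂ result) (cong (λ z → step (moveAt m) s r (stateOf (acyclic V T) (components V T) z p)) (sym unscanned-suc)))
    where
    T′ : List Edge
    T′ = scanEdges (roles m) s r T
    p : Profile
    p = profileOf T (roles m)
    unscanned-suc : n ∸ m ≡ suc (n ∸ suc m)
    unscanned-suc = +-∸-assoc 1 {n} {suc m} m<n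
    clT : Closed V T
    clT = scanned-closed m (≤-trans (n≤1+n m) m<n) ∘ T⊆
    tracked-after : Tracks T′ (roles m) (afterStep p s r) × components V T′ + merges p s r ≡ components V T
                    × acyclic V T′ ≡ not (closesCycle p s r) ∧ acyclic V T
    tracked-after = scan-tracks T (roles m) p s r (scanned-closed (suc m) m<n ∘ scanEdges-⊆ m T⊆ s r) (roles∈V m m<n)
      (tracks-fresh clT (roles∈V m m<n) (next-isolated m m<n ∘ T⊆) (roles-distinct m m<n))
    moved : profileOf T′ (roles (suc m)) ≡ restrict (moveAt m) (afterStep p s r)
    moved = profileOf-moved {σ = moveAt m} (roles-suc m) (proj₁ tracked-after)
    result : (n ∸ suc m) + classes (restrict (moveAt m) (afterStep p s r)) ≤ components V T′
             × stateOf (acyclic V T′) (components V T′) (n ∸ suc m) (restrict (moveAt m) (afterStep p s r))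
               ≡ step (moveAt m) s r (stateOf (acyclic V T) (components V T) (suc (n ∸ suc m)) p)
    result = step-stateOf (moveAt m) p s r (acyclic V T) (acyclic V T′) (components V T) (components V T′) (n ∸ suc m)
      (checked (stepCount (moveAt m)) (moveAt-counts m) p (profileOf-transitive clT (roles∈V m m<n)))
      (subst (λ z → z + classes p ≤ components V T) unscanned-suc inv)
      (proj₁ (proj₂ tracked-after)) (proj₂ (proj₂ tracked-after))

  profileOf-[] : profileOf [] (roles 0) ≡ all-connected
  profileOf-[] rewrite connected-refl {[]} {0} (λ ()) (vertex∈ z≤n) = refl

  components-empty : components V [] ≡ suc n
  components-empty = trans (Components.components-[] V (upTo⁺ (suc n))) (length-applyUpTo (λ z → z) (suc n))

  invariant-[] : Invariant 0 []
  invariant-[] = subst₂ (λ p c → n + classes p ≤ c) (sym profileOf-[]) (sym components-empty) (≤-reflexive (+-comm n 1))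

  stateAt-[] : stateAt 0 [] ≡ live all-connected
  stateAt-[] = trans (cong₂ (λ c p → stateOf true c n p) components-empty profileOf-[]) all-isolated
    where
    all-isolated : stateOf true (suc n) n all-connected ≡ live all-connected
    all-isolated rewrite +-comm n 1 | ≡ᵇ-refl n = refl

  invariant-suc : ∀ m → suc (suc m) ≤ n → (∀ {T} → T ∈ sublists (scanned (suc m)) → Invariant (suc m) T) →
    ∀ {T} → T ∈ sublists (scanned (suc (suc m))) → Invariant (suc (suc m)) T
  invariant-suc m m<n ih k with ∈-sublists-∷ {(0 , label (suc (suc m)))} {(label (suc m) , label (suc (suc m))) ∷ scanned (suc m)} k
  ... | b , T₁ , k₁ , refl with ∈-sublists-∷ {(label (suc m) , label (suc (suc m)))} {scanned (suc m)} k₁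
  ... | r , T₀ , k₀ , refl = proj₁ (scan-step (suc m) m<n T₀ (∈-sublists⇒⊆ (scanned (suc m)) k₀) (ih k₀) b r)

  invariant : ∀ m → m ≤ n → ∀ {T} → T ∈ sublists (scanned m) → Invariant m T
  invariant zero _ (here refl) = invariant-[]
  invariant (suc zero) m≤n k with ∈-sublists-∷ {(0 , label 1)} {[]} k
  ... | b , .[] , here refl , refl = proj₁ (scan-step 0 m≤n [] (λ ()) invariant-[] b false)
  invariant (suc (suc m)) m≤n = invariant-suc m m≤n (invariant (suc m) (≤-trans (n≤1+n (suc m)) m≤n))

  weightAt : ℕ → (State → ℕ) → ℕ
  weightAt m w = sublistSum (w ∘ stateAt m) (scanned m)

  weightAt-0 : ∀ w → weightAt 0 w ≡ w (live all-connected)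
  weightAt-0 w = trans (+-identityʳ _) (cong w stateAt-[])

  -- At the first step last = centre, so only the spoke of v_i can be added.
  weightAt-1 : ∀ w → weightAt 1 w ≡ weightAt 0 (transfer₀ w)
  weightAt-1 w = trans (cong₂ (λ u v → w u + (w v + 0)) (sym (first false)) (sym (first true)))
    (trans (cong (w (step firstMove false false (stateAt 0 [])) +_) (+-identityʳ _)) (sym (+-identityʳ _)))
    where
    first : ∀ b → step firstMove b false (stateAt 0 []) ≡ stateAt 1 (opt b (0 , label 1) [])
    first b = sym (proj₂ (scan-step 0 n≥1 [] (λ ()) invariant-[] b false))

  weightAt-suc : ∀ m → suc (suc m) ≤ n → ∀ w → weightAt (suc (suc m)) w ≡ weightAt (suc m) (transfer (moveAt (suc m)) w)
  weightAt-suc m m<n w = begin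
    sublistSum h (sp ∷ rm ∷ L)
      ≡⟨ sublistSum-∷ h sp (rm ∷ L) ⟩
    sublistSum h (rm ∷ L) + sublistSum (h ∘ (sp ∷_)) (rm ∷ L)
      ≡⟨ cong₂ _+_ (sublistSum-∷ h rm L) (sublistSum-∷ (h ∘ (sp ∷_)) rm L) ⟩
    (sublistSum (h ∘ opt false sp ∘ opt false rm) L + sublistSum (h ∘ opt false sp ∘ opt true rm) L)
      + (sublistSum (h ∘ opt true sp ∘ opt false rm) L + sublistSum (h ∘ opt true sp ∘ opt true rm) L)
      ≡⟨ cong₂ _+_ (cong₂ _+_ (stepped false false) (stepped false true)) (cong₂ _+_ (stepped true false) (stepped true true)) ⟩
    (sublistSum (f false false) L + sublistSum (f false true) L) + (sublistSum (f true false) L + sublistSum (f true true) L)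
      ≡⟨ cong₂ _+_ (sublistSum-+ (f false false) (f false true) L) (sublistSum-+ (f true false) (f true true) L) ⟩
    sublistSum _ L + sublistSum _ L
      ≡⟨ sublistSum-+ _ _ L ⟩
    weightAt (suc m) (transfer (moveAt (suc m)) w) ∎
    where
    h : List Edge → ℕ
    h = w ∘ stateAt (suc (suc m))
    sp rm : Edge
    sp = (0 , label (suc (suc m)))
    rm = (label (suc m) , label (suc (suc m)))
    L : List Edge
    L = scanned (suc m)
    f : Bool → Bool → List Edge → ℕ
    f s r T = w (step (moveAt (suc m)) s r (stateAt (suc m) T))
    stepped : ∀ s r → sublistSum (h ∘ opt s sp ∘ opt r rm) L ≡ sublistSum (f s r) L
    stepped s r = sum-map-cong _ _ (sublists L) λ {T} k →
      cong w (proj₂ (scan-step (suc m) m<n T (∈-sublists⇒⊆ L k) (invariant (suc m) (≤-trans (n≤1+n (suc m)) m<n) k) s r))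

  finalRoles : Slot → ℕ
  finalRoles centre = 0
  finalRoles start = label 1
  finalRoles last = label n
  finalRoles target = targetVertex n
  finalRoles fresh = 0

  finalRoles∈V : SlotsIn finalRoles
  finalRoles∈V centre = vertex∈ z≤n
  finalRoles∈V start = vertex∈ (label≤n n≥1)
  finalRoles∈V last = vertex∈ (label≤n ≤-refl)
  finalRoles∈V target = vertex∈ (targetVertex≤n n ≤-refl)
  finalRoles∈V fresh = vertex∈ z≤n

  profileOf-cong : ∀ {T ρ ρ′} → (∀ x → x ∈ tracked → ρ x ≡ ρ′ x) → profileOf T ρ ≡ profileOf T ρ′
  profileOf-cong {T} {ρ} {ρ′} same =
    profile-cong (pair centre start centre∈ start∈) (pair centre last centre∈ last∈) (pair centre target centre∈ target∈)
                 (pair start last start∈ last∈) (pair start target start∈ target∈) (pair last target last∈ target∈)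
    where
    pair : ∀ x y → x ∈ tracked → y ∈ tracked → connected V T (ρ x) (ρ y) ≡ connected V T (ρ′ x) (ρ′ y)
    pair x y x∈ y∈ = cong₂ (connected V T) (same x x∈) (same y y∈)

  roles-n : ∀ x → x ∈ tracked → roles n x ≡ finalRoles x
  roles-n x x∈ = trans (cong (λ z → roles z x) (sym suc-pred-n)) (at-end x x∈)
    where
    at-end : ∀ x → x ∈ tracked → roles (suc (n ∸ 1)) x ≡ finalRoles x
    at-end centre _ = refl
    at-end start _ = refl
    at-end last _ = cong label suc-pred-n
    at-end target _ = cong targetVertex suc-pred-n
    at-end fresh f∈ = ⊥-elim (fresh∉tracked f∈)

  final-accepts : ∀ {T} → T ∈ sublists (scanned n) → ∀ c →
    isSeparatingTwoForest n (label 1) (targetVertex n) (opt c closingEdge T) ≡ acceptForest c (stateAt n T)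
    × isSpanningTree n (opt c closingEdge T) ≡ acceptTree c (stateAt n T)
  final-accepts {T} k c = trans (proj₁ accepted) (cong (acceptForest c) (sym final-state)) ,
                          trans (proj₂ accepted) (cong (acceptTree c) (sym final-state))
    where
    clT : Closed V T
    clT = scanned-closed n ≤-refl ∘ ∈-sublists⇒⊆ (scanned n) k
    T′ : List Edge
    T′ = opt c closingEdge T
    closed-with : ∀ b → Closed V (opt b closingEdge T)
    closed-with true (here refl) = finalRoles∈V last , finalRoles∈V start
    closed-with true (there m) = clT m
    closed-with false m = clT m
    p : Profile
    p = profileOf T finalRoles
    closing : TracksTracked T′ finalRoles (afterClose p c) × components V T′ + mergesᶜ p c ≡ components V T
              × acyclic V T′ ≡ not (closesCycleᶜ p c) ∧ acyclic V T
    closing = close-tracks T finalRoles p c (closed-with c) finalRoles∈V (tracks-profileOf clT finalRoles∈V)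
    bound : classes p ≤ components V T
    bound = subst₂ (λ z w → z + classes w ≤ components V T) (n∸n≡0 n) (profileOf-cong roles-n) (invariant n ≤-refl k)
    accepted : acyclic V T′ ∧ ((components V T′ ≡ᵇ 2) ∧ not (connected V T′ (label 1) (targetVertex n)))
                 ≡ acceptForest c (stateOf (acyclic V T) (components V T) 0 p)
               × acyclic V T′ ∧ (components V T′ ≡ᵇ 1) ≡ acceptTree c (stateOf (acyclic V T) (components V T) 0 p)
    accepted = close-stateOf p c (acyclic V T) (acyclic V T′) (components V T) (components V T′)
      (connected V T′ (label 1) (targetVertex n)) (checked closeCount close-counts p (profileOf-transitive clT finalRoles∈V))
      bound (proj₁ (proj₂ closing)) (proj₂ (proj₂ closing)) (proj₁ closing start target start∈ target∈)
    final-state : stateAt n T ≡ stateOf (acyclic V T) (components V T) 0 p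
    final-state = cong₂ (stateOf (acyclic V T) (components V T)) (n∸n≡0 n) (profileOf-cong roles-n)

  count-as-weight : ∀ (P : List Edge → Bool) (accept : Bool → State → Bool) → PermInvariant P →
    (∀ {T} → T ∈ sublists (scanned n) → ∀ c → P (opt c closingEdge T) ≡ accept c (stateAt n T)) →
    length (filterᵇ P (sublists (wheelEdges n))) ≡ weightAt n (λ st → toℕ (accept false st) + toℕ (accept true st))
  count-as-weight P accept inv accepts = begin
    length (filterᵇ P (sublists (wheelEdges n)))
      ≡⟨ length-filterᵇ P (sublists (wheelEdges n)) ⟩
    sublistSum (toℕ ∘ P) (wheelEdges n)
      ≡⟨ sym (sublistSum-↭ scan-↭-wheelEdges (toℕ ∘ P) (cong toℕ ∘ inv)) ⟩
    sublistSum (toℕ ∘ P) (closingEdge ∷ scanned n)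
      ≡⟨ sublistSum-∷ (toℕ ∘ P) closingEdge (scanned n) ⟩
    sublistSum (toℕ ∘ P) (scanned n) + sublistSum (toℕ ∘ P ∘ (closingEdge ∷_)) (scanned n)
      ≡⟨ cong₂ _+_ (sum-map-cong _ _ (sublists (scanned n)) (λ k → cong toℕ (accepts k false)))
                   (sum-map-cong _ _ (sublists (scanned n)) (λ k → cong toℕ (accepts k true))) ⟩
    sublistSum (toℕ ∘ accept false ∘ stateAt n) (scanned n) + sublistSum (toℕ ∘ accept true ∘ stateAt n) (scanned n)
      ≡⟨ sublistSum-+ _ _ (scanned n) ⟩
    weightAt n (λ st → toℕ (accept false st) + toℕ (accept true st)) ∎

  forestCount-weight : twoForestCount n (label 1) (targetVertex n) ≡ weightAt n forestWeight
  forestCount-weight = count-as-weight _ acceptForest perm-invariant (λ k c → proj₁ (final-accepts k c))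
    where
    perm-invariant : PermInvariant (isSeparatingTwoForest n (label 1) (targetVertex n))
    perm-invariant q = cong₂ _∧_ (acyclic-↭ V q) (cong₂ _∧_ (cong (_≡ᵇ 2) (components-↭ V q)) (cong not (connected-↭ V _ _ q)))

  treeCount-weight : spanningTreeCount n ≡ weightAt n treeWeight
  treeCount-weight = count-as-weight _ acceptTree perm-invariant (λ k c → proj₂ (final-accepts k c))
    where
    perm-invariant : PermInvariant (isSpanningTree n)
    perm-invariant q = cong₂ _∧_ (acyclic-↭ V q) (cong (_≡ᵇ 1) (components-↭ V q))

  weightAt-cong : ∀ m w w′ → (∀ st → w st ≡ w′ st) → weightAt m w ≡ weightAt m w′
  weightAt-cong m w w′ h = sublistSum-cong _ _ (scanned m) (h ∘ stateAt m)

  transferⁿ-transfer : ∀ k w st → transferⁿ k (transfer plainMove w) st ≡ transfer plainMove (transferⁿ k w) st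
  transferⁿ-transfer zero w st = refl
  transferⁿ-transfer (suc k) w st = cong₂ _+_ (cong₂ _+_ (again _) (again _)) (cong₂ _+_ (again _) (again _))
    where
    again : ∀ st → transferⁿ k (transfer plainMove w) st ≡ transfer plainMove (transferⁿ k w) st
    again = transferⁿ-transfer k w

  moveAt-plain : ∀ m → suc m ≢ d → moveAt (suc m) ≡ plainMove
  moveAt-plain m ne rewrite ≢⇒≡ᵇ-false ne = refl

  moveAt-target : ∀ d′ → d ≡ suc d′ → moveAt (suc d′) ≡ targetMove
  moveAt-target d′ eq rewrite trans (cong (suc d′ ≡ᵇ_) eq) (≡ᵇ-refl (suc d′)) = refl

  weightAt-unroll : ∀ k m → suc m + k ≤ n → (∀ t → suc m ≤ t → t < suc m + k → t ≢ d) → ∀ w →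
    weightAt (suc m + k) w ≡ weightAt (suc m) (transferⁿ k w)
  weightAt-unroll zero m _ _ w = cong (λ z → weightAt z w) (+-identityʳ (suc m))
  weightAt-unroll (suc k) m le no-target w = begin
    weightAt (suc m + suc k) w
      ≡⟨ cong (λ z → weightAt z w) (+-suc (suc m) k) ⟩
    weightAt (suc (suc (m + k))) w
      ≡⟨ weightAt-suc (m + k) le′ w ⟩
    weightAt (suc (m + k)) (transfer (moveAt (suc (m + k))) w)
      ≡⟨ cong (λ σ → weightAt (suc (m + k)) (transfer σ w)) (moveAt-plain (m + k) (no-target _ (s≤s (m≤m+n m k)) last<)) ⟩
    weightAt (suc m + k) (transfer plainMove w)
      ≡⟨ weightAt-unroll k m (≤-trans (n≤1+n _) le′) (λ t a b → no-target t a (≤-trans b (≤-trans (n≤1+n _) last<))) _ ⟩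
    weightAt (suc m) (transferⁿ k (transfer plainMove w))
      ≡⟨ weightAt-cong (suc m) _ _ (transferⁿ-transfer k w) ⟩
    weightAt (suc m) (transferⁿ (suc k) w) ∎
    where
    le′ : suc (suc (m + k)) ≤ n
    le′ = subst (_≤ n) (+-suc (suc m) k) le
    last< : suc (m + k) < suc m + suc k
    last< = ≤-reflexive (sym (+-suc (suc m) k))

  weightAt-1-states : ∀ w → weightAt 1 w ≡ w (live start-alone) + w (live all-connected)
  weightAt-1-states w = trans (weightAt-1 w) (weightAt-0 (transfer₀ w))

  forest-closed-form : ∀ d′ L → d ≡ suc d′ → n ≡ suc d + L →
    twoForestCount n (label 1) (targetVertex n) ≡ ⟦ d′ ∣ L ⟧² (forestCoef² start-alone) + ⟦ d′ ∣ L ⟧² (forestCoef² all-connected)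
  forest-closed-form d′ L refl n≡ = begin
    twoForestCount n (label 1) (targetVertex n)
      ≡⟨ forestCount-weight ⟩
    weightAt n forestWeight
      ≡⟨ cong (λ z → weightAt z forestWeight) n≡ ⟩
    weightAt (suc d + L) forestWeight
      ≡⟨ weightAt-unroll L d (≤-reflexive (sym n≡)) (λ t d<t _ t≡d → <-irrefl (sym t≡d) d<t) forestWeight ⟩
    weightAt (suc (suc d′)) (transferⁿ L forestWeight)
      ≡⟨ weightAt-suc d′ d<n (transferⁿ L forestWeight) ⟩
    weightAt (suc d′) (transfer (moveAt (suc d′)) (transferⁿ L forestWeight))
      ≡⟨ cong (λ σ → weightAt (suc d′) (transfer σ (transferⁿ L forestWeight))) (moveAt-target d′ refl) ⟩
    weightAt (1 + d′) (transfer targetMove (transferⁿ L forestWeight))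
      ≡⟨ weightAt-unroll d′ 0 (≤-trans (n≤1+n _) d<n) (λ t _ t<d t≡d → <-irrefl t≡d t<d) _ ⟩
    weightAt 1 (transferⁿ d′ (transfer targetMove (transferⁿ L forestWeight)))
      ≡⟨ weightAt-1-states (transferⁿ d′ (transfer targetMove (transferⁿ L forestWeight))) ⟩
    transferⁿ d′ (transfer targetMove (transferⁿ L forestWeight)) (live start-alone)
      + transferⁿ d′ (transfer targetMove (transferⁿ L forestWeight)) (live all-connected)
      ≡⟨ cong₂ _+_ (forest-before-target L d′ start-alone refl) (forest-before-target L d′ all-connected refl) ⟩
    ⟦ d′ ∣ L ⟧² (forestCoef² start-alone) + ⟦ d′ ∣ L ⟧² (forestCoef² all-connected) ∎
    where
    d<n : suc d ≤ n
    d<n = subst (suc d ≤_) (sym n≡) (m≤m+n (suc d) L)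

  tree-closed-form : n ≤ d → spanningTreeCount n ≡ ⟦ n ∸ 1 ⟧ (treeCoef start-alone) + ⟦ n ∸ 1 ⟧ (treeCoef all-connected)
  tree-closed-form n≤d = begin
    spanningTreeCount n
      ≡⟨ treeCount-weight ⟩
    weightAt n treeWeight
      ≡⟨ cong (λ z → weightAt z treeWeight) (sym suc-pred-n) ⟩
    weightAt (1 + (n ∸ 1)) treeWeight
      ≡⟨ weightAt-unroll (n ∸ 1) 0 (≤-reflexive suc-pred-n) (λ t _ t<n t≡d → <-irrefl refl (≤-trans (subst (_< n) t≡d (subst (t <_) suc-pred-n t<n)) n≤d)) treeWeight ⟩
    weightAt 1 (transferⁿ (n ∸ 1) treeWeight)
      ≡⟨ weightAt-1-states (transferⁿ (n ∸ 1) treeWeight) ⟩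
    transferⁿ (n ∸ 1) treeWeight (live start-alone) + transferⁿ (n ∸ 1) treeWeight (live all-connected)
      ≡⟨ cong₂ _+_ (tree-solution (n ∸ 1) _ refl) (tree-solution (n ∸ 1) _ refl) ⟩
    ⟦ n ∸ 1 ⟧ (treeCoef start-alone) + ⟦ n ∸ 1 ⟧ (treeCoef all-connected) ∎

-- Fibonacci and Lucas identities

φ⁺ : ℕ → ℕ
φ⁺ x = suc (ψ x)

fib-φψ : ∀ x → fib (2 * x) ≡ φ x × fib (suc (2 * x)) ≡ φ⁺ x
fib-φψ zero = refl , refl
fib-φψ (suc x) with fib-φψ x
... | even , odd =
  trans (cong fib (*-suc 2 x)) (trans (cong₂ _+_ odd even)
    (solve 2 (λ A E → (con 1 :+ E) :+ A := A :+ E :+ con 1) refl (φ x) (ψ x))) ,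
  trans (cong (fib ∘ suc) (*-suc 2 x)) (trans (cong₂ (λ u v → (u + v) + u) odd even)
    (solve 2 (λ A E → ((con 1 :+ E) :+ A) :+ (con 1 :+ E) := con 1 :+ (A :+ con 2 :* E :+ con 1)) refl (φ x) (ψ x)))

lucas+fib : ∀ m → lucas m + fib m ≡ 2 * fib (suc m)
lucas+fib zero = refl
lucas+fib (suc zero) = refl
lucas+fib (suc (suc m)) = begin
  (lucas (suc m) + lucas m) + (fib (suc m) + fib m)
    ≡⟨ solve 4 (λ l₁ l₀ f₁ f₀ → (l₁ :+ l₀) :+ (f₁ :+ f₀) := (l₁ :+ f₁) :+ (l₀ :+ f₀)) refl (lucas (suc m)) (lucas m) (fib (suc m)) (fib m) ⟩
  (lucas (suc m) + fib (suc m)) + (lucas m + fib m)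
    ≡⟨ cong₂ _+_ (lucas+fib (suc m)) (lucas+fib m) ⟩
  2 * fib (suc (suc m)) + 2 * fib (suc m)
    ≡⟨ sym (*-distribˡ-+ 2 (fib (suc (suc m))) (fib (suc m))) ⟩
  2 * fib (suc (suc (suc m))) ∎

φ≤ψ : ∀ x → φ x ≤ ψ x
φ≤ψ zero = z≤n
φ≤ψ (suc x) = +-monoˡ-≤ 1 (+-monoʳ-≤ (φ x) (m≤m+n (ψ x) (ψ x + 0)))

wheelTrees : ℕ → ℕ
wheelTrees x = lucas (2 * x) ∸ 2

lucas+φ : ∀ x → lucas (2 * x) + φ x ≡ 2 + 2 * ψ x
lucas+φ x = begin
  lucas (2 * x) + φ x          ≡⟨ cong (lucas (2 * x) +_) (sym (proj₁ (fib-φψ x))) ⟩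
  lucas (2 * x) + fib (2 * x)  ≡⟨ lucas+fib (2 * x) ⟩
  2 * fib (suc (2 * x))        ≡⟨ cong (2 *_) (proj₂ (fib-φψ x)) ⟩
  2 * φ⁺ x                     ≡⟨ *-suc 2 (ψ x) ⟩
  2 + 2 * ψ x ∎

wheelTrees+φ : ∀ x → wheelTrees x + φ x ≡ 2 * ψ x
wheelTrees+φ x = +-cancelˡ-≡ 2 _ _ (begin
  2 + (wheelTrees x + φ x)   ≡⟨ solve 2 (λ m a → con 2 :+ (m :+ a) := (m :+ con 2) :+ a) refl (wheelTrees x) (φ x) ⟩
  (wheelTrees x + 2) + φ x   ≡⟨ cong (_+ φ x) (m∸n+n≡m 2≤lucas) ⟩
  lucas (2 * x) + φ x        ≡⟨ lucas+φ x ⟩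
  2 + 2 * ψ x ∎)
  where
  2≤lucas : 2 ≤ lucas (2 * x)
  2≤lucas = +-cancelʳ-≤ (φ x) 2 (lucas (2 * x))
    (≤-trans (+-monoʳ-≤ 2 (≤-trans (φ≤ψ x) (m≤m+n (ψ x) (ψ x + 0)))) (≤-reflexive (sym (lucas+φ x))))

φ-+ : ∀ x y → φ (suc (x + y)) ≡ φ⁺ x * φ (suc y) + φ x * φ⁺ y × φ⁺ (suc (x + y)) ≡ φ (suc x) * φ (suc y) + φ⁺ x * φ⁺ y
φ-+ x zero rewrite +-identityʳ x =
  solve 2 (λ A E → A :+ E :+ con 1 := (con 1 :+ E) :* (con 0 :+ con 0 :+ con 1) :+ A :* con 1) refl (φ x) (ψ x) ,
  solve 2 (λ A E → con 1 :+ (A :+ con 2 :* E :+ con 1) := (A :+ E :+ con 1) :* (con 0 :+ con 0 :+ con 1) :+ (con 1 :+ E) :* con 1) refl (φ x) (ψ x)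
φ-+ x (suc y) rewrite +-suc x y with φ-+ x y
... | ih₁ , ih₂ = even , odd
  where
  A E : ℕ
  A = φ (suc (x + y))
  E = ψ (suc (x + y))
  even : A + E + 1 ≡ φ⁺ x * φ (suc (suc y)) + φ x * φ⁺ (suc y)
  even = begin
    A + E + 1
      ≡⟨ solve 2 (λ u v → u :+ v :+ con 1 := u :+ (con 1 :+ v)) refl A E ⟩
    A + suc E
      ≡⟨ cong₂ _+_ ih₁ ih₂ ⟩
    (φ⁺ x * φ (suc y) + φ x * φ⁺ y) + (φ (suc x) * φ (suc y) + φ⁺ x * φ⁺ y)
      ≡⟨ solve 4 (λ ax ex ay ey → ((con 1 :+ ex) :* (ay :+ ey :+ con 1) :+ ax :* (con 1 :+ ey)) :+ ((ax :+ ex :+ con 1) :* (ay :+ ey :+ con 1) :+ (con 1 :+ ex) :* (con 1 :+ ey))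
               := (con 1 :+ ex) :* ((ay :+ ey :+ con 1) :+ (ay :+ con 2 :* ey :+ con 1) :+ con 1) :+ ax :* (con 1 :+ (ay :+ con 2 :* ey :+ con 1))) refl (φ x) (ψ x) (φ y) (ψ y) ⟩
    φ⁺ x * φ (suc (suc y)) + φ x * φ⁺ (suc y) ∎
  odd : suc (A + 2 * E + 1) ≡ φ (suc x) * φ (suc (suc y)) + φ⁺ x * φ⁺ (suc y)
  odd = begin
    suc (A + 2 * E + 1)
      ≡⟨ solve 2 (λ u v → con 1 :+ (u :+ con 2 :* v :+ con 1) := u :+ con 2 :* (con 1 :+ v)) refl A E ⟩
    A + 2 * suc E
      ≡⟨ cong₂ (λ p q → p + 2 * q) ih₁ ih₂ ⟩
    (φ⁺ x * φ (suc y) + φ x * φ⁺ y) + 2 * (φ (suc x) * φ (suc y) + φ⁺ x * φ⁺ y)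
      ≡⟨ solve 4 (λ ax ex ay ey → ((con 1 :+ ex) :* (ay :+ ey :+ con 1) :+ ax :* (con 1 :+ ey)) :+ con 2 :* ((ax :+ ex :+ con 1) :* (ay :+ ey :+ con 1) :+ (con 1 :+ ex) :* (con 1 :+ ey))
               := (ax :+ ex :+ con 1) :* ((ay :+ ey :+ con 1) :+ (ay :+ con 2 :* ey :+ con 1) :+ con 1) :+ (con 1 :+ ex) :* (con 1 :+ (ay :+ con 2 :* ey :+ con 1))) refl (φ x) (ψ x) (φ y) (ψ y) ⟩
    φ (suc x) * φ (suc (suc y)) + φ⁺ x * φ⁺ (suc y) ∎

-- Cassini's identity f_{2k+1}² = f_{2k} f_{2k+2} + 1.
cassini : ∀ k → φ⁺ k * φ⁺ k ≡ φ k * φ k + φ k * φ⁺ k + 1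
cassini zero = refl
cassini (suc k) = begin
  suc (φ k + 2 * ψ k + 1) * suc (φ k + 2 * ψ k + 1)
    ≡⟨ solve 2 (λ A E → (con 1 :+ (A :+ con 2 :* E :+ con 1)) :* (con 1 :+ (A :+ con 2 :* E :+ con 1)) := A :* A :+ con 4 :* A :* (con 1 :+ E) :+ con 3 :* ((con 1 :+ E) :* (con 1 :+ E)) :+ (con 1 :+ E) :* (con 1 :+ E)) refl (φ k) (ψ k) ⟩
  φ k * φ k + 4 * φ k * φ⁺ k + 3 * (φ⁺ k * φ⁺ k) + φ⁺ k * φ⁺ k
    ≡⟨ cong (λ z → φ k * φ k + 4 * φ k * φ⁺ k + 3 * (φ⁺ k * φ⁺ k) + z) (cassini k) ⟩
  φ k * φ k + 4 * φ k * φ⁺ k + 3 * (φ⁺ k * φ⁺ k) + (φ k * φ k + φ k * φ⁺ k + 1)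
    ≡⟨ solve 2 (λ A E → A :* A :+ con 4 :* A :* (con 1 :+ E) :+ con 3 :* ((con 1 :+ E) :* (con 1 :+ E)) :+ (A :* A :+ A :* (con 1 :+ E) :+ con 1)
         := (A :+ E :+ con 1) :* (A :+ E :+ con 1) :+ (A :+ E :+ con 1) :* (con 1 :+ (A :+ con 2 :* E :+ con 1)) :+ con 1) refl (φ k) (ψ k) ⟩
  φ (suc k) * φ (suc k) + φ (suc k) * φ⁺ (suc k) + 1 ∎

-- d'Ocagne's identity f_{2(k+y)} f_{2k+1} − f_{2k} f_{2(k+y)+1} = f_{2y}, proved together with
-- its companion for the odd index.
dOcagne : ∀ k y → φ (k + y) * φ⁺ k ≡ φ k * φ⁺ (k + y) + φ y × φ⁺ (k + y) * φ⁺ k ≡ φ k * φ (k + y) + φ k * φ⁺ (k + y) + φ⁺ y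
dOcagne k zero rewrite +-identityʳ k = sym (+-identityʳ _) , cassini k
dOcagne k (suc y) rewrite +-suc k y with dOcagne k y
... | ih₁ , ih₂ = even , odd
  where
  A E : ℕ
  A = φ (k + y)
  E = ψ (k + y)
  even : (A + E + 1) * φ⁺ k ≡ φ k * suc (A + 2 * E + 1) + (φ y + ψ y + 1)
  even = begin
    (A + E + 1) * φ⁺ k
      ≡⟨ solve 3 (λ u v w → (u :+ v :+ con 1) :* w := u :* w :+ (con 1 :+ v) :* w) refl A E (φ⁺ k) ⟩
    A * φ⁺ k + φ⁺ (k + y) * φ⁺ k
      ≡⟨ cong₂ _+_ ih₁ ih₂ ⟩
    (φ k * φ⁺ (k + y) + φ y) + (φ k * A + φ k * φ⁺ (k + y) + φ⁺ y)
      ≡⟨ solve 5 (λ ak u v ay ey → (ak :* (con 1 :+ v) :+ ay) :+ (ak :* u :+ ak :* (con 1 :+ v) :+ (con 1 :+ ey))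
               := ak :* (con 1 :+ (u :+ con 2 :* v :+ con 1)) :+ (ay :+ ey :+ con 1)) refl (φ k) A E (φ y) (ψ y) ⟩
    φ k * suc (A + 2 * E + 1) + (φ y + ψ y + 1) ∎
  odd : suc (A + 2 * E + 1) * φ⁺ k ≡ φ k * (A + E + 1) + φ k * suc (A + 2 * E + 1) + suc (φ y + 2 * ψ y + 1)
  odd = begin
    suc (A + 2 * E + 1) * φ⁺ k
      ≡⟨ solve 3 (λ u v w → (con 1 :+ (u :+ con 2 :* v :+ con 1)) :* w := u :* w :+ con 2 :* ((con 1 :+ v) :* w)) refl A E (φ⁺ k) ⟩
    A * φ⁺ k + 2 * (φ⁺ (k + y) * φ⁺ k)
      ≡⟨ cong₂ (λ p q → p + 2 * q) ih₁ ih₂ ⟩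
    (φ k * φ⁺ (k + y) + φ y) + 2 * (φ k * A + φ k * φ⁺ (k + y) + φ⁺ y)
      ≡⟨ solve 5 (λ ak u v ay ey → (ak :* (con 1 :+ v) :+ ay) :+ con 2 :* (ak :* u :+ ak :* (con 1 :+ v) :+ (con 1 :+ ey))
               := ak :* (u :+ v :+ con 1) :+ ak :* (con 1 :+ (u :+ con 2 :* v :+ con 1)) :+ (con 1 :+ (ay :+ con 2 :* ey :+ con 1))) refl (φ k) A E (φ y) (ψ y) ⟩
    φ k * (A + E + 1) + φ k * suc (A + 2 * E + 1) + suc (φ y + 2 * ψ y + 1) ∎

tree-coefficients : ∀ m → ⟦ m ⟧ (treeCoef start-alone) + ⟦ m ⟧ (treeCoef all-connected)
  ≡ wheelTrees (suc m)
tree-coefficients m = +-cancelʳ-≡ (φ (suc m)) _ _ (trans expansion (sym (wheelTrees+φ (suc m))))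
  where
  expansion : ⟦ m ⟧ (lin 0 0 2) + ⟦ m ⟧ (lin 1 1 1) + φ (suc m) ≡ 2 * ψ (suc m)
  expansion = solve 2 (λ A E → ((con 0 :+ con 0 :* A :+ con 2 :* E) :+ (con 1 :+ con 1 :* A :+ con 1 :* E)) :+ (A :+ E :+ con 1)
                         := con 2 :* (A :+ con 2 :* E :+ con 1)) refl (φ m) (ψ m)

forest-coefficients : ∀ d′ L →
  ⟦ d′ ∣ L ⟧² (forestCoef² start-alone) + ⟦ d′ ∣ L ⟧² (forestCoef² all-connected)
  + 2 * φ (suc d′) + 2 * φ (suc L) ≡ 2 * φ (suc (suc d′ + L))
forest-coefficients d′ L = trans expansion (sym (cong (2 *_) (proj₁ (φ-+ (suc d′) L))))
  where
  expansion : ⟦ d′ ∣ L ⟧² (lin² (lin 1 1 3) (lin 1 1 3) (lin 3 3 5)) + ⟦ d′ ∣ L ⟧² (lin² (lin 1 1 1) (lin 1 1 1) (lin 1 1 1))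
        + 2 * φ (suc d′) + 2 * φ (suc L) ≡ 2 * (φ⁺ (suc d′) * φ (suc L) + φ (suc d′) * φ⁺ L)
  expansion = solve 4 (λ ad ed aL eL →
      (((con 1 :+ con 1 :* aL :+ con 3 :* eL) :+ ad :* (con 1 :+ con 1 :* aL :+ con 3 :* eL) :+ ed :* (con 3 :+ con 3 :* aL :+ con 5 :* eL))
       :+ ((con 1 :+ con 1 :* aL :+ con 1 :* eL) :+ ad :* (con 1 :+ con 1 :* aL :+ con 1 :* eL) :+ ed :* (con 1 :+ con 1 :* aL :+ con 1 :* eL)))
      :+ con 2 :* (ad :+ ed :+ con 1) :+ con 2 :* (aL :+ eL :+ con 1)
      := con 2 :* ((con 1 :+ (ad :+ con 2 :* ed :+ con 1)) :* (aL :+ eL :+ con 1) :+ (ad :+ ed :+ con 1) :* (con 1 :+ eL)))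
      refl (φ d′) (ψ d′) (φ L) (ψ L)

-- Multiply out with wheelTrees+φ and use d'Ocagne's identity.
separated-formula : ∀ count k y → count + 2 * φ k + 2 * φ y ≡ 2 * φ (k + y) →
  count + φ (k + y) * wheelTrees k ≡ φ k * wheelTrees (k + y)
separated-formula count k y h = +-cancelʳ-≡ (N * K) _ _ (begin
    count + N * wheelTrees k + N * K
      ≡⟨ solve 4 (λ c n m k′ → c :+ n :* m :+ n :* k′ := c :+ n :* (m :+ k′)) refl count N (wheelTrees k) K ⟩
    count + N * (wheelTrees k + K)
      ≡⟨ cong (λ z → count + N * z) (wheelTrees+φ k) ⟩
    count + N * (2 * ψ k)
      ≡⟨ solve 3 (λ c n e′ → c :+ n :* (con 2 :* e′) := c :+ con 2 :* n :* e′) refl count N (ψ k) ⟩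
    count + 2 * N * ψ k
      ≡⟨ +-cancelʳ-≡ _ _ _ expanded ⟩
    2 * K * ψ (k + y)
      ≡⟨ solve 2 (λ k′ en′ → con 2 :* k′ :* en′ := k′ :* (con 2 :* en′)) refl K (ψ (k + y)) ⟩
    K * (2 * ψ (k + y))
      ≡⟨ cong (K *_) (sym (wheelTrees+φ (k + y))) ⟩
    K * (wheelTrees (k + y) + N)
      ≡⟨ solve 3 (λ k′ m n → k′ :* (m :+ n) := k′ :* m :+ n :* k′) refl K (wheelTrees (k + y)) N ⟩
    K * wheelTrees (k + y) + N * K ∎)
  where
  N K Y : ℕ
  N = φ (k + y)
  K = φ k
  Y = φ y
  expanded : count + 2 * N * ψ k + (2 * K + 2 * Y + 2 * N) ≡ 2 * K * ψ (k + y) + (2 * K + 2 * Y + 2 * N)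
  expanded = begin
    count + 2 * N * ψ k + (2 * K + 2 * Y + 2 * N)
      ≡⟨ solve 5 (λ c n k′ y′ e′ → (c :+ con 2 :* n :* e′) :+ (con 2 :* k′ :+ con 2 :* y′ :+ con 2 :* n) := (c :+ con 2 :* k′ :+ con 2 :* y′) :+ con 2 :* (n :* (con 1 :+ e′))) refl count N K Y (ψ k) ⟩
    (count + 2 * K + 2 * Y) + 2 * (N * φ⁺ k)
      ≡⟨ cong₂ (λ p q → p + 2 * q) h (proj₁ (dOcagne k y)) ⟩
    2 * N + 2 * (K * φ⁺ (k + y) + Y)
      ≡⟨ solve 4 (λ n k′ y′ en′ → con 2 :* n :+ con 2 :* (k′ :* (con 1 :+ en′) :+ y′) := con 2 :* k′ :* en′ :+ (con 2 :* k′ :+ con 2 :* y′ :+ con 2 :* n)) refl N K Y (ψ (k + y)) ⟩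
    2 * K * ψ (k + y) + (2 * K + 2 * Y + 2 * N) ∎

spanning-tree-count : ∀ n → 1 ≤ n → spanningTreeCount n ≡ wheelTrees n
spanning-tree-count n 1≤n = begin
  spanningTreeCount n
    ≡⟨ Scan.tree-closed-form 0 n 1≤n n 1≤n ≤-refl ⟩
  ⟦ n ∸ 1 ⟧ (treeCoef start-alone) + ⟦ n ∸ 1 ⟧ (treeCoef all-connected)
    ≡⟨ tree-coefficients (n ∸ 1) ⟩
  wheelTrees (suc (n ∸ 1))
    ≡⟨ cong wheelTrees (Rotation.suc-pred-n 0 n 1≤n) ⟩
  wheelTrees n ∎

module _ (s q : ℕ) (q≥1 : 1 ≤ q) where

  open Rotation s q q≥1

  separated-count : ∀ d → 1 ≤ d → d < n → twoForestCount n (suc s) (label (suc d)) + 2 * φ d + 2 * φ (n ∸ d) ≡ 2 * φ n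
  separated-count (suc d′) 1≤d d<n = begin
    twoForestCount n (suc s) (label (suc (suc d′))) + 2 * φ (suc d′) + 2 * φ (n ∸ suc d′)
      ≡⟨ cong₂ (λ i j → twoForestCount n i j + 2 * φ (suc d′) + 2 * φ (n ∸ suc d′)) i≡label-1 (sym target≡) ⟩
    twoForestCount n (label 1) (Scan.targetVertex s q q≥1 (suc d′) 1≤d n) + 2 * φ (suc d′) + 2 * φ (n ∸ suc d′)
      ≡⟨ cong₂ (λ c m → c + 2 * φ (suc d′) + 2 * φ m) (Scan.forest-closed-form s q q≥1 (suc d′) 1≤d d′ L refl n≡) n∸d≡1+L ⟩
    ⟦ d′ ∣ L ⟧² (forestCoef² start-alone) + ⟦ d′ ∣ L ⟧² (forestCoef² all-connected) + 2 * φ (suc d′) + 2 * φ (suc L)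
      ≡⟨ forest-coefficients d′ L ⟩
    2 * φ (suc (suc d′) + L)
      ≡⟨ cong (λ m → 2 * φ m) (sym n≡) ⟩
    2 * φ n ∎
    where
    L : ℕ
    L = n ∸ suc (suc d′)
    n≡ : n ≡ suc (suc d′) + L
    n≡ = sym (m+[n∸m]≡n d<n)
    n∸d≡1+L : n ∸ suc d′ ≡ suc L
    n∸d≡1+L = trans (cong (_∸ suc d′) (trans n≡ (sym (+-suc (suc d′) L)))) (m+n∸m≡n (suc d′) (suc L))
    i≡label-1 : suc s ≡ label 1
    i≡label-1 = sym (trans label-1 (+-comm s 1))
    target≡ : Scan.targetVertex s q q≥1 (suc d′) 1≤d n ≡ label (suc (suc d′))
    target≡ = Scan.targetVertex-> s q q≥1 (suc d′) 1≤d d<n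

separated-relation : ∀ n i j → 1 ≤ i → i ≤ n → 1 ≤ j → j ≤ n → i ≢ j →
  twoForestCount n i j + 2 * φ ∣ i - j ∣ + 2 * φ (n ∸ ∣ i - j ∣) ≡ 2 * φ n
separated-relation n (suc s) j _ i≤n 1≤j j≤n i≢j with n ∸ s | m+[n∸m]≡n (<⇒≤ i≤n) | m<n⇒0<n∸m i≤n
... | q | refl | q≥1 with Rotation.scan-position s q q≥1 j 1≤j j≤n i≢j
... | d , 1≤d , d<n , label≡j , distance = either-distance ∣ suc s - j ∣ distance
  where
  count : ℕ
  count = twoForestCount (s + q) (suc s) j
  at-d : count + 2 * φ d + 2 * φ (s + q ∸ d) ≡ 2 * φ (s + q)
  at-d = subst (λ v → twoForestCount (s + q) (suc s) v + 2 * φ d + 2 * φ (s + q ∸ d) ≡ 2 * φ (s + q)) label≡j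
               (separated-count s q q≥1 d 1≤d d<n)
  either-distance : ∀ D → D ≡ d ⊎ D ≡ s + q ∸ d → count + 2 * φ D + 2 * φ (s + q ∸ D) ≡ 2 * φ (s + q)
  either-distance _ (inj₁ refl) = at-d
  either-distance _ (inj₂ refl) = begin
    count + 2 * φ (n ∸ d) + 2 * φ (n ∸ (n ∸ d))  ≡⟨ cong (λ m → count + 2 * φ (n ∸ d) + 2 * φ m) (m∸[m∸n]≡n (<⇒≤ d<n)) ⟩
    count + 2 * φ (n ∸ d) + 2 * φ d              ≡⟨ +-swapʳ count _ _ ⟩
    count + 2 * φ d + 2 * φ (n ∸ d)              ≡⟨ at-d ⟩
    2 * φ n ∎

separated-formula-min : ∀ n D count → D ≤ n → count + 2 * φ D + 2 * φ (n ∸ D) ≡ 2 * φ n →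
  count + φ n * wheelTrees (D ⊓ (n ∸ D)) ≡ φ (D ⊓ (n ∸ D)) * wheelTrees n
separated-formula-min n D count D≤n h with ≤-total D (n ∸ D)
... | inj₁ le rewrite m≤n⇒m⊓n≡m le =
  subst (λ m → count + φ m * wheelTrees D ≡ φ D * wheelTrees m) (m+[n∸m]≡n D≤n)
        (separated-formula count D (n ∸ D) (trans h (cong (λ m → 2 * φ m) (sym (m+[n∸m]≡n D≤n)))))
... | inj₂ ge rewrite m≥n⇒m⊓n≡n ge =
  subst (λ m → count + φ m * wheelTrees (n ∸ D) ≡ φ (n ∸ D) * wheelTrees m) (m∸n+n≡m D≤n)
        (separated-formula count (n ∸ D) D (trans (+-swapʳ count _ _) (trans h (cong (λ m → 2 * φ m) (sym (m∸n+n≡m D≤n))))))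

∣i-j∣≤n : ∀ {n i j} → i ≤ n → j ≤ n → ∣ i - j ∣ ≤ n
∣i-j∣≤n {i = i} {j} i≤n j≤n = ≤-trans (∣m-n∣≤m⊔n i j) (⊔-lub i≤n j≤n)

-- Imported only here: the prefix +_ would make the sections (m +_) above ambiguous.
open import Data.Integer using (+_; _-_)
open import Data.Integer.Properties using (m-n≡m⊖n; ⊖-≥)

+-difference : ∀ {x y z} → x + y ≡ z → + x ≡ + z - + y
+-difference {x} {y} refl = sym (trans (m-n≡m⊖n (x + y) y) (trans (⊖-≥ (m≤n+m y x)) (cong +_ (m+n∸n≡m x y))))

theorem2 : (n i j : ℕ) → 3 ≤ n → 1 ≤ i → i ≤ n → 1 ≤ j → j ≤ n → i ≢ j →
    ((+ twoForestCount n i j)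
    ≡ (+ (fib (2 * (∣ i - j ∣ ⊓ (n ∸ ∣ i - j ∣))) * spanningTreeCount n))
    - (+ (fib (2 * n) * (lucas (2 * (∣ i - j ∣ ⊓ (n ∸ ∣ i - j ∣))) ∸ 2))))
    × ((+ twoForestCount n i j)
    ≡ (+ (fib (2 * (∣ i - j ∣ ⊓ (n ∸ ∣ i - j ∣))) * (lucas (2 * n) ∸ 2)))
    - (+ (fib (2 * n) * (lucas (2 * (∣ i - j ∣ ⊓ (n ∸ ∣ i - j ∣))) ∸ 2))))
theorem2 n i j _ 1≤i i≤n 1≤j j≤n i≢j =
  subst (λ t → + twoForestCount n i j ≡ + (fib (2 * k) * t) - + (fib (2 * n) * wheelTrees k)) (sym trees) formula , formula
  where
  k : ℕ
  k = ∣ i - j ∣ ⊓ (n ∸ ∣ i - j ∣)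
  trees : spanningTreeCount n ≡ wheelTrees n
  trees = spanning-tree-count n (≤-trans 1≤i i≤n)
  formula : + twoForestCount n i j ≡ + (fib (2 * k) * wheelTrees n) - + (fib (2 * n) * wheelTrees k)
  formula rewrite proj₁ (fib-φψ k) | proj₁ (fib-φψ n) =
    +-difference (separated-formula-min n ∣ i - j ∣ _ (∣i-j∣≤n i≤n j≤n) (separated-relation n i j 1≤i i≤n 1≤j j≤n i≢j))
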